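{- Let $G=(V,E)$ be a cubic planar graph with a fixed planar embedding, and let $I$ be the following instance of Shortest disjoint $A,B$-paths. For every $v\in V$, add a cycle $v'_1,v'_2,\ldots,v'_8$ (in clockwise order) where the edge $v'_8v'_1$ has length $12$, and for $i\in\{1,\ldots,7\}$ the edge $v'_iv'_{i+1}$ has length $2$ if $i$ is odd and length $1$ if $i$ is even; put $v'_1,v'_8$ into $A$. For every edge $uv\in E$, add two new vertices $w'_1,w'_2$, put them into $B$, and add edges $w'_1u'_i$, $w'_2u'_{i+1}$, $w'_1v'_j$, $w'_2v'_{j-1}$ of length $1$, where $i\in\{2,4,6\}$ and $j\in\{3,5,7\}$, chosen so that each cycle vertex is used by at most one such edge and the resulting graph $I$ is planar (using the embedding of $G$ and ordering the edges at each vertex clockwise). Let $\ell_{A,B}$ and $S_{A,B}$ be the minimum length and the number of minimum-length solutions of Disjoint $A,B$-paths on $I$. Then the maximum independent set size of $G$ is $\alpha(G)=12|V|+3|E|-\ell_{A,B}$, and the number of maximum independent sets of $G$ is $S_{A,B}/2^{|E|-3\alpha(G)}$.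
   Context: A solution to Disjoint $A,B$-paths in a graph with edge lengths $\ell$ and disjoint vertex subsets $A,B$ is an edge subset $E'$ that is the union of $\frac12(|A|+|B|)$ pairwise vertex-disjoint paths, each having both endpoints in $A$ or both endpoints in $B$; its length is the sum of $\ell$ over $E'$. $\ell_{A,B}$ is the minimum length of a solution and $S_{A,B}$ the number of solutions (as edge sets) of that length. -}

module Defs where

open import Data.Nat using (ℕ; zero; suc; _+_; _*_; _≤_)
open import Data.Nat.DivMod using (_/_)
open import Data.Fin using (Fin; toℕ) renaming (zero to fz; suc to fs)
open import Data.Fin.Subset using (Subset; _∈_; _∉_; ∣_∣)
open import Data.Bool using (Bool; true; false; if_then_else_)
open import Data.Product using (∃-syntax; _×_; _,_; proj₁; proj₂)
open import Data.Sum using (_⊎_)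
open import Data.Empty using (⊥)
open import Data.Unit using (⊤)
open import Data.List using (List; []; _∷_; length)
open import Data.List.Relation.Unary.All using (All)
open import Data.List.Relation.Unary.Any using (Any)
open import Data.List.Relation.Unary.AllPairs using (AllPairs)
open import Data.List.Relation.Unary.Unique.Propositional using (Unique)
import Data.List.Membership.Propositional as LM
open import Relation.Binary.PropositionalEquality using (_≡_; _≢_)
open import Relation.Nullary using (¬_)
open import Function.Bundles using (_⇔_)

record CountOf {A : Set} (_≈_ : A → A → Set) (P : A → Set) (k : ℕ) : Set where
  field
    elems    : List A
    size     : length elems ≡ k
    distinct : AllPairs (λ x y → ¬ (x ≈ y)) elems
    sound    : All P elems
    complete : ∀ x → P x → Any (x ≈_) elems

ΣFin : (n : ℕ) → (Fin n → ℕ) → ℕ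
ΣFin zero    f = 0
ΣFin (suc n) f = f fz + ΣFin n (λ i → f (fs i))

iter : {A : Set} → (A → A) → ℕ → A → A
iter f zero    x = x
iter f (suc k) x = f (iter f k x)

-- Cubic simple graphs with a combinatorial embedding (rotation system).
-- Vertices are Fin n; each vertex v has three darts (v , 0), (v , 1), (v , 2),
-- listed in CLOCKWISE order around v.  `opp` pairs up darts into edges.

Dart : ℕ → Set
Dart n = Fin n × Fin 3

rot3 : Fin 3 → Fin 3
rot3 fz           = fs fz
rot3 (fs fz)      = fs (fs fz)
rot3 (fs (fs fz)) = fz

record CubicMap (n : ℕ) : Set where
  field
    opp       : Dart n → Dart n
    opp-invol : ∀ d → opp (opp d) ≡ d
    no-loop   : ∀ d → proj₁ (opp d) ≢ proj₁ d
    no-multi  : ∀ v p q → proj₁ (opp (v , p)) ≡ proj₁ (opp (v , q)) → p ≡ q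
open CubicMap public

-- |E| (= 3n/2 by the handshake lemma)
numEdges : ℕ → ℕ
numEdges n = (3 * n) / 2

face : ∀ {n} → CubicMap n → Dart n → Dart n
face G d = proj₁ (opp G d) , rot3 (proj₂ (opp G d))

dkey : ∀ {n} → Dart n → ℕ
dkey (v , p) = 3 * toℕ v + toℕ p

SameFace : ∀ {n} → CubicMap n → Dart n → Dart n → Set
SameFace G d d' = ∃[ k ] iter (face G) k d ≡ d'

-- d is the chosen representative (minimal key) of its face
FaceRep : ∀ {n} → CubicMap n → Dart n → Set
FaceRep G d = ∀ d' → SameFace G d d' → dkey d ≤ dkey d'

data Reach {n} (G : CubicMap n) : Fin n → Fin n → Set where
  here : ∀ {v} → Reach G v v
  step : ∀ {v w} (p : Fin 3) → Reach G (proj₁ (opp G (v , p))) w → Reach G v w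

-- v is the chosen representative (minimal index) of its connected component
CompRep : ∀ {n} → CubicMap n → Fin n → Set
CompRep G v = ∀ w → Reach G v w → toℕ v ≤ toℕ w

-- The rotation system is a planar embedding: Euler's formula
-- |V| - |E| + |F| = 2 * (#components), i.e. every component has genus 0.
Planar : ∀ {n} → CubicMap n → Set
Planar {n} G = ∃[ f ] ∃[ c ]
  (CountOf _≡_ (FaceRep G) f × CountOf _≡_ (CompRep G) c
   × n + f ≡ 2 * c + numEdges n)

Independent : ∀ {n} → CubicMap n → Subset n → Set
Independent G S = ∀ d → proj₁ d ∈ S → proj₁ (opp G d) ∉ S

MaxIndep : ∀ {n} → CubicMap n → ℕ → Subset n → Set
MaxIndep G a S = Independent G S × ∣ S ∣ ≡ a

IsIndepNumber : ∀ {n} → CubicMap n → ℕ → Set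
IsIndepNumber G a = (∃[ S ] MaxIndep G a S) × (∀ S → Independent G S → ∣ S ∣ ≤ a)

-- The instance I.
-- cyc v k  is  v'_{k+1}  (k = 0..7), cycle vertices in clockwise order.
-- ter d    for a dart d = (u , p) of edge uv: the two darts of an edge give w'_1, w'_2.

data VI (n : ℕ) : Set where
  cyc : Fin n → Fin 8 → VI n
  ter : Dart n → VI n

data EI (n : ℕ) : Set where
  cycE : Fin n → Fin 8 → EI n   -- edge v'_{k+1} v'_{k+2}  (indices mod 8)
  evE  : Dart n → EI n          -- w'_1 u'_i   with i = 2p+2 ∈ {2,4,6}
  odE  : Dart n → EI n          -- w'_1 v'_j   with j = 2q+3 ∈ {3,5,7}

next8 : Fin 8 → Fin 8
next8 fz = fs fz
next8 (fs fz) = fs (fs fz)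
next8 (fs (fs fz)) = fs (fs (fs fz))
next8 (fs (fs (fs fz))) = fs (fs (fs (fs fz)))
next8 (fs (fs (fs (fs fz)))) = fs (fs (fs (fs (fs fz))))
next8 (fs (fs (fs (fs (fs fz))))) = fs (fs (fs (fs (fs (fs fz)))))
next8 (fs (fs (fs (fs (fs (fs fz)))))) = fs (fs (fs (fs (fs (fs (fs fz))))))
next8 (fs (fs (fs (fs (fs (fs (fs fz))))))) = fz

lenCyc : Fin 8 → ℕ
lenCyc fz = 2
lenCyc (fs fz) = 1
lenCyc (fs (fs fz)) = 2
lenCyc (fs (fs (fs fz))) = 1
lenCyc (fs (fs (fs (fs fz)))) = 2
lenCyc (fs (fs (fs (fs (fs fz))))) = 1
lenCyc (fs (fs (fs (fs (fs (fs fz)))))) = 2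
lenCyc (fs (fs (fs (fs (fs (fs (fs fz))))))) = 12

-- port p ↦ 0-based index of v'_{2p+2}
evenIx : Fin 3 → Fin 8
evenIx fz = fs fz
evenIx (fs fz) = fs (fs (fs fz))
evenIx (fs (fs fz)) = fs (fs (fs (fs (fs fz))))

-- port q ↦ 0-based index of v'_{2q+3}
oddIx : Fin 3 → Fin 8
oddIx fz = fs (fs fz)
oddIx (fs fz) = fs (fs (fs (fs fz)))
oddIx (fs (fs fz)) = fs (fs (fs (fs (fs (fs fz)))))

ends : ∀ {n} → CubicMap n → EI n → VI n × VI n
ends G (cycE v k) = cyc v k , cyc v (next8 k)
ends G (evE d)    = ter d , cyc (proj₁ d) (evenIx (proj₂ d))
ends G (odE d)    = ter d , cyc (proj₁ (opp G d)) (oddIx (proj₂ (opp G d)))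

lenI : ∀ {n} → EI n → ℕ
lenI (cycE v k) = lenCyc k
lenI (evE d)    = 1
lenI (odE d)    = 1

InA : ∀ {n} → VI n → Set
InA (cyc v k) = (toℕ k ≡ 0) ⊎ (toℕ k ≡ 7)
InA (ter d)   = ⊥

InB : ∀ {n} → VI n → Set
InB (cyc v k) = ⊥
InB (ter d)   = ⊤

Joins : ∀ {n} → CubicMap n → EI n → VI n → VI n → Set
Joins G e x y = (ends G e ≡ (x , y)) ⊎ (ends G e ≡ (y , x))

data Walk {n} (G : CubicMap n) : VI n → VI n → Set where
  nil  : ∀ x → Walk G x x
  cons : ∀ {x y z} (e : EI n) → Joins G e x y → Walk G y z → Walk G x z

wverts : ∀ {n} {G : CubicMap n} {x y} → Walk G x y → List (VI n)
wverts (nil x) = x ∷ []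
wverts (cons {x = x} e _ w) = x ∷ wverts w

wedges : ∀ {n} {G : CubicMap n} {x y} → Walk G x y → List (EI n)
wedges (nil x) = []
wedges (cons e _ w) = e ∷ wedges w

record ABPath {n} (G : CubicMap n) : Set where
  field
    src tgt  : VI n
    walk     : Walk G src tgt
    distinct : Unique (wverts walk)
    nonTriv  : 1 ≤ length (wedges walk)
    endsOK   : (InA src × InA tgt) ⊎ (InB src × InB tgt)
open ABPath public

VDisjoint : ∀ {n} {G : CubicMap n} → ABPath G → ABPath G → Set
VDisjoint P Q = ∀ x → x LM.∈ wverts (walk P) → x LM.∈ wverts (walk Q) → ⊥

-- (|A| + |B|) / 2  with |A| = 2|V| and |B| = 2|E| = 3|V|
numPaths : ℕ → ℕ
numPaths n = (2 * n + 3 * n) / 2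

EdgeSet : ℕ → Set
EdgeSet n = EI n → Bool

Solution : ∀ {n} → CubicMap n → EdgeSet n → Set
Solution {n} G E' = ∃[ ps ] (length ps ≡ numPaths n
  × AllPairs (VDisjoint {G = G}) ps
  × (∀ e → (E' e ≡ true) ⇔ Any (λ P → e LM.∈ wedges (walk P)) ps))

wt : Bool → ℕ → ℕ
wt b w = if b then w else 0

lengthOf : ∀ {n} → EdgeSet n → ℕ
lengthOf {n} E' =
  ΣFin n (λ v → ΣFin 8 (λ k → wt (E' (cycE v k)) (lenCyc k)))
  + ΣFin n (λ v → ΣFin 3 (λ p → wt (E' (evE (v , p))) 1 + wt (E' (odE (v , p))) 1))

IsMinLength : ∀ {n} → CubicMap n → ℕ → Set
IsMinLength G ℓ = (∃[ E' ] Solution G E' × lengthOf E' ≡ ℓ)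
  × (∀ E' → Solution G E' → ℓ ≤ lengthOf E')

OptSolution : ∀ {n} → CubicMap n → ℕ → EdgeSet n → Set
OptSolution G ℓ E' = Solution G E' × lengthOf E' ≡ ℓ

_≐_ : ∀ {n} → EdgeSet n → EdgeSet n → Set
E₁ ≐ E₂ = ∀ e → E₁ e ≡ E₂ e

module Submission where

-- In a solution every vertex gadget carries an A-path from v′₁ to v′₈: either the closing
-- edge (length 12) or the way round the cycle (length 11), which occupies all of it. Every
-- edge uv of G carries a B-path of length 3 through a tie pair and one cycle edge of u or
-- of v, so it must avoid gadgets taken the long way: these form an independent set S, and
-- the length is 12|V| + 3|E| − |S|. Conversely an independent set S, together with a free
-- choice of side for each of the |E| − 3|S| edges not touching S, gives such a solution.
-- The lower bound is proved gadget by gadget: a finite check shows that twice the weight of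
-- a feasible gadget (its cycle length, plus one if taken the long way) is at least 24 plus
-- its number of used tie edges, with equality only for the shapes of the construction.

open import Defs
open import Data.Nat using (ℕ; zero; suc; _+_; _*_; _∸_; _^_; _≤_; z≤n; s≤s; _≤?_; _<?_; _≟_)
open import Data.Nat.Properties
open import Data.Nat.DivMod using (_/_; m*n/n≡m)
open import Data.Nat.Tactic.RingSolver using (solve-∀)
open import Data.Fin using (Fin; toℕ; inject₁; _↑ˡ_; #_) renaming (zero to fz; suc to fs)
import Data.Fin.Properties as Fin
open import Data.Fin.Subset using (Subset; _∈_; ∣_∣)
open import Data.Fin.Subset.Properties using (∣p∣≤n)
open import Data.Bool using (Bool; true; false; if_then_else_; not; _∧_; _∨_; _xor_; T)
import Data.Bool.Properties as Bool
open import Data.Bool.Properties using (not-injective)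
open import Data.Product using (∃-syntax; _×_; _,_; proj₁; proj₂)
open import Data.Sum using (_⊎_; inj₁; inj₂)
open import Data.Empty using (⊥; ⊥-elim)
open import Data.Unit using (tt)
open import Data.Vec using (Vec; []; _∷_; lookup; tabulate)
open import Data.Vec.Properties using (lookup∘tabulate; []=⇒lookup; lookup⇒[]=; ≡-dec; tabulate∘lookup; tabulate-cong)
open import Data.List using (List; []; _∷_; length; _++_; map; allFin)
open import Data.List.Properties using (length-++; length-map; length-tabulate)
open import Data.List.Relation.Unary.All using (All; []; _∷_)
import Data.List.Relation.Unary.All as All
import Data.List.Relation.Unary.All.Properties as All
open import Data.List.Relation.Unary.Any using (Any; here; there)
import Data.List.Relation.Unary.Any as Any
import Data.List.Relation.Unary.Any.Properties as Any
open import Data.List.Relation.Unary.AllPairs using (AllPairs; []; _∷_)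
import Data.List.Relation.Unary.AllPairs.Properties as AllPairs
open import Data.List.Relation.Unary.Unique.Propositional using (Unique)
import Data.List.Relation.Unary.Unique.Propositional.Properties as Unique
open import Data.List.Membership.Propositional using (find; lose) renaming (_∈_ to _∈ₗ_)
import Data.List.Membership.DecPropositional as DecMembership
open import Data.List.Membership.Propositional.Properties
  using (∈-++⁺ˡ; ∈-++⁺ʳ; ∈-++⁻; ∈-map⁺; ∈-map⁻; ∈-tabulate⁻; ∈-allFin)
open import Relation.Binary.PropositionalEquality
open import Relation.Binary.Definitions using (DecidableEquality)
open import Relation.Nullary using (¬_; Dec; yes; no; does)
open import Relation.Nullary.Decidable using (⌊_⌋; T?; toWitness; map′; _×-dec_; _→-dec_; does-⇔; dec-true; dec-false)
open import Function using (_∘_; case_of_)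
open import Function.Bundles using (_⇔_; mk⇔; Equivalence)

true≢false : ∀ {b} → b ≡ true → b ≡ false → ⊥
true≢false refl ()

∨-elim : ∀ a {b} → a ∨ b ≡ true → a ≡ true ⊎ b ≡ true
∨-elim true  _    = inj₁ refl
∨-elim false b≡true = inj₂ b≡true

bit : Bool → ℕ
bit true  = 1
bit false = 0

wt-1 : ∀ b → wt b 1 ≡ bit b
wt-1 true  = refl
wt-1 false = refl

bit-∧ : ∀ a b → bit (a ∧ b) ≡ bit a * bit b
bit-∧ true  b = sym (+-identityʳ (bit b))
bit-∧ false b = refl

bit-not : ∀ b → bit b + bit (not b) ≡ 1
bit-not true  = refl
bit-not false = refl

bit-xor : ∀ a b → T (a xor b) → bit a + bit b ≡ 1
bit-xor true  false _ = refl
bit-xor false true  _ = refl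

+-+-interchange : ∀ a b c d → a + b + (c + d) ≡ a + c + (b + d)
+-+-interchange = solve-∀

+-comm-last : ∀ a b c → a + b + c ≡ a + c + b
+-comm-last = solve-∀

ΣFin-cong : ∀ k {f g : Fin k → ℕ} → (∀ i → f i ≡ g i) → ΣFin k f ≡ ΣFin k g
ΣFin-cong zero    f≗g = refl
ΣFin-cong (suc k) f≗g = cong₂ _+_ (f≗g fz) (ΣFin-cong k (f≗g ∘ fs))

ΣFin-+ : ∀ k (f g : Fin k → ℕ) → ΣFin k (λ i → f i + g i) ≡ ΣFin k f + ΣFin k g
ΣFin-+ zero    f g = refl
ΣFin-+ (suc k) f g rewrite ΣFin-+ k (f ∘ fs) (g ∘ fs) =
  +-+-interchange (f fz) (g fz) (ΣFin k (f ∘ fs)) (ΣFin k (g ∘ fs))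

ΣFin-*ˡ : ∀ k c (f : Fin k → ℕ) → ΣFin k (λ i → c * f i) ≡ c * ΣFin k f
ΣFin-*ˡ zero    c f = sym (*-zeroʳ c)
ΣFin-*ˡ (suc k) c f rewrite ΣFin-*ˡ k c (f ∘ fs) = sym (*-distribˡ-+ c (f fz) _)

ΣFin-const : ∀ k c → ΣFin k (λ _ → c) ≡ k * c
ΣFin-const zero    c = refl
ΣFin-const (suc k) c = cong (c +_) (ΣFin-const k c)

ΣFin-zero : ∀ k {f : Fin k → ℕ} → (∀ i → f i ≡ 0) → ΣFin k f ≡ 0
ΣFin-zero k f≗0 = trans (ΣFin-cong k f≗0) (trans (ΣFin-const k 0) (*-zeroʳ k))

ΣFin-swap : ∀ a b (h : Fin a → Fin b → ℕ) →
  ΣFin a (λ i → ΣFin b (h i)) ≡ ΣFin b (λ j → ΣFin a (λ i → h i j))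
ΣFin-swap zero    b h = sym (ΣFin-zero b (λ _ → refl))
ΣFin-swap (suc a) b h = begin
  ΣFin b (h fz) + ΣFin a (λ i → ΣFin b (h (fs i)))
    ≡⟨ cong (ΣFin b (h fz) +_) (ΣFin-swap a b (h ∘ fs)) ⟩
  ΣFin b (h fz) + ΣFin b (λ j → ΣFin a (λ i → h (fs i) j))
    ≡⟨ ΣFin-+ b (h fz) _ ⟨
  ΣFin b (λ j → h fz j + ΣFin a (λ i → h (fs i) j)) ∎
  where open ≡-Reasoning

ΣFin-mono-≤ : ∀ k {f g : Fin k → ℕ} → (∀ i → f i ≤ g i) → ΣFin k f ≤ ΣFin k g
ΣFin-mono-≤ zero    f≤g = z≤n
ΣFin-mono-≤ (suc k) f≤g = +-mono-≤ (f≤g fz) (ΣFin-mono-≤ k (f≤g ∘ fs))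

ΣFin-≤-tight : ∀ k {f g : Fin k → ℕ} → (∀ i → f i ≤ g i) → ΣFin k g ≤ ΣFin k f →
  ∀ i → f i ≡ g i
ΣFin-≤-tight (suc k) {f} {g} f≤g Σg≤Σf fz = ≤-antisym (f≤g fz)
  (+-cancelʳ-≤ _ _ _ (≤-trans (+-monoʳ-≤ (g fz) (ΣFin-mono-≤ k (f≤g ∘ fs))) Σg≤Σf))
ΣFin-≤-tight (suc k) {f} {g} f≤g Σg≤Σf (fs i) = ΣFin-≤-tight k (f≤g ∘ fs)
  (+-cancelˡ-≤ (g fz) _ _ (≤-trans Σg≤Σf (+-monoˡ-≤ _ (f≤g fz)))) i

ΣFin-indicator : ∀ k (x : Fin k) (g : Fin k → ℕ) →
  ΣFin k (λ i → bit (does (i Fin.≟ x)) * g i) ≡ g x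
ΣFin-indicator (suc k) fz     g =
  trans (cong (g fz + 0 +_) (ΣFin-zero k (λ _ → refl))) (trans (+-identityʳ _) (+-identityʳ _))
ΣFin-indicator (suc k) (fs x) g = ΣFin-indicator k x (g ∘ fs)

∣∣≡ΣFin : ∀ {n} (S : Subset n) → ∣ S ∣ ≡ ΣFin n (bit ∘ lookup S)
∣∣≡ΣFin []          = refl
∣∣≡ΣFin (true ∷ S)  = cong suc (∣∣≡ΣFin S)
∣∣≡ΣFin (false ∷ S) = ∣∣≡ΣFin S

module _ {X : Set} where

  concatFin : ∀ k → (Fin k → List X) → List X
  concatFin zero    F = []
  concatFin (suc k) F = F fz ++ concatFin k (F ∘ fs)

  ∈-concatFin⁺ : ∀ k (F : Fin k → List X) i {x} → x ∈ₗ F i → x ∈ₗ concatFin k F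
  ∈-concatFin⁺ (suc k) F fz     x∈ = ∈-++⁺ˡ x∈
  ∈-concatFin⁺ (suc k) F (fs i) x∈ = ∈-++⁺ʳ (F fz) (∈-concatFin⁺ k (F ∘ fs) i x∈)

  ∈-concatFin⁻ : ∀ k (F : Fin k → List X) {x} → x ∈ₗ concatFin k F → ∃[ i ] x ∈ₗ F i
  ∈-concatFin⁻ (suc k) F x∈ with ∈-++⁻ (F fz) x∈
  ... | inj₁ x∈F₀ = fz , x∈F₀
  ... | inj₂ x∈Fₛ with ∈-concatFin⁻ k (F ∘ fs) x∈Fₛ
  ...   | i , x∈Fᵢ = fs i , x∈Fᵢ

  length-concatFin : ∀ k (F : Fin k → List X) →
    length (concatFin k F) ≡ ΣFin k (length ∘ F)
  length-concatFin zero    F = refl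
  length-concatFin (suc k) F =
    trans (length-++ (F fz)) (cong (length (F fz) +_) (length-concatFin k (F ∘ fs)))

  AllPairs-concatFin : ∀ {R : X → X → Set} k (F : Fin k → List X) →
    (∀ i → AllPairs R (F i)) →
    (∀ i j → i ≢ j → ∀ {x y} → x ∈ₗ F i → y ∈ₗ F j → R x y) →
    AllPairs R (concatFin k F)
  AllPairs-concatFin zero    F _     _     = []
  AllPairs-concatFin (suc k) F inner cross = AllPairs.++⁺ (inner fz)
    (AllPairs-concatFin k (F ∘ fs) (inner ∘ fs)
      (λ i j i≢j → cross (fs i) (fs j) (i≢j ∘ Fin.suc-injective)))
    (All.tabulate λ x∈ → All.tabulate λ y∈ →
      let j , y∈Fⱼ = ∈-concatFin⁻ k (F ∘ fs) y∈ in cross fz (fs j) (λ ()) x∈ y∈Fⱼ)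

  removeAt : ∀ {P : X → Set} ys → Any P ys → List X
  removeAt (y ∷ ys) (here _)  = ys
  removeAt (y ∷ ys) (there i) = y ∷ removeAt ys i

  length-removeAt : ∀ {P : X → Set} ys (i : Any P ys) → suc (length (removeAt ys i)) ≡ length ys
  length-removeAt (y ∷ ys) (here _)  = refl
  length-removeAt (y ∷ ys) (there i) = cong suc (length-removeAt ys i)

  Any-removeAt : ∀ {P Q : X → Set} ys (i : Any P ys) → Any Q ys →
    (∀ {y} → P y → Q y → ⊥) → Any Q (removeAt ys i)
  Any-removeAt (y ∷ ys) (here p)  (here q)  P∩Q=∅ = ⊥-elim (P∩Q=∅ p q)
  Any-removeAt (y ∷ ys) (here p)  (there j) P∩Q=∅ = j
  Any-removeAt (y ∷ ys) (there i) (here q)  P∩Q=∅ = here q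
  Any-removeAt (y ∷ ys) (there i) (there j) P∩Q=∅ = there (Any-removeAt ys i j P∩Q=∅)

  -- The join hypothesis makes distinct elements of xs use distinct matches in ys.
  length-≤-by-matching : ∀ (R : X → X → Set) → (∀ {a b c} → R a b → R c b → R a c) →
    ∀ xs ys → AllPairs (λ a b → ¬ R a b) xs → All (λ x → Any (R x) ys) xs →
    length xs ≤ length ys
  length-≤-by-matching R R-join [] ys _ _ = z≤n
  length-≤-by-matching R R-join (x ∷ xs) ys (x≁xs ∷ distinct) (x~ys ∷ matched) =
    subst (suc (length xs) ≤_) (length-removeAt ys x~ys)
      (s≤s (length-≤-by-matching R R-join xs (removeAt ys x~ys) distinct
        (All.zipWith (λ (x≁z , z~ys) → Any-removeAt ys x~ys z~ys (λ p q → x≁z (R-join p q)))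
          (x≁xs , matched))))

  AllPairs-map-∈ : ∀ {R S : X → X → Set} {xs} → (∀ {x y} → x ∈ₗ xs → y ∈ₗ xs → R x y → S x y) →
    AllPairs R xs → AllPairs S xs
  AllPairs-map-∈ R⇒S []         = []
  AllPairs-map-∈ R⇒S (Rx ∷ Rxs) =
    All.tabulate (λ y∈ → R⇒S (here refl) (there y∈) (All.lookup Rx y∈))
    ∷ AllPairs-map-∈ (λ x∈ y∈ → R⇒S (there x∈) (there y∈)) Rxs

  AllPairs-lookup : ∀ {R : X → X → Set} {xs} → AllPairs R xs → ∀ {x y} →
    x ∈ₗ xs → y ∈ₗ xs → x ≡ y ⊎ R x y ⊎ R y x
  AllPairs-lookup (_ ∷ _)  (here refl) (here refl) = inj₁ refl
  AllPairs-lookup (r ∷ _)  (here refl) (there y∈) = inj₂ (inj₁ (All.lookup r y∈))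
  AllPairs-lookup (r ∷ _)  (there x∈) (here refl) = inj₂ (inj₂ (All.lookup r x∈))
  AllPairs-lookup (_ ∷ rs) (there x∈) (there y∈) = AllPairs-lookup rs x∈ y∈

_≟ᴰ_ : ∀ {n} → DecidableEquality (Dart n)
(v , p) ≟ᴰ (w , q) =
  map′ (λ (v≡w , p≡q) → cong₂ _,_ v≡w p≡q) (λ { refl → refl , refl }) (v Fin.≟ w ×-dec p Fin.≟ q)

module Darts {n : ℕ} (G : CubicMap n) where

  ΣD : (Dart n → ℕ) → ℕ
  ΣD f = ΣFin n (λ v → ΣFin 3 (λ p → f (v , p)))

  ΣD-cong : {f g : Dart n → ℕ} → (∀ d → f d ≡ g d) → ΣD f ≡ ΣD g
  ΣD-cong f≗g = ΣFin-cong n (λ v → ΣFin-cong 3 (λ p → f≗g (v , p)))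

  ΣD-+ : (f g : Dart n → ℕ) → ΣD (λ d → f d + g d) ≡ ΣD f + ΣD g
  ΣD-+ f g = trans (ΣFin-cong n (λ v → ΣFin-+ 3 (λ p → f (v , p)) (λ p → g (v , p))))
                   (ΣFin-+ n _ _)

  ΣD-const : ∀ c → ΣD (λ _ → c) ≡ n * (3 * c)
  ΣD-const c = trans (ΣFin-cong n (λ v → ΣFin-const 3 c)) (ΣFin-const n (3 * c))

  ΣD-indicator : ∀ x (g : Dart n → ℕ) → ΣD (λ e → bit (does (e ≟ᴰ x)) * g e) ≡ g x
  ΣD-indicator (w , q) g = begin
    ΣFin n (λ v → ΣFin 3 (λ p → bit (does (v Fin.≟ w) ∧ does (p Fin.≟ q)) * g (v , p)))
      ≡⟨ ΣFin-cong n (λ v → ΣFin-cong 3 (λ p →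
           trans (cong (_* g (v , p)) (bit-∧ (does (v Fin.≟ w)) (does (p Fin.≟ q))))
                 (*-assoc (bit (does (v Fin.≟ w))) _ _))) ⟩
    ΣFin n (λ v → ΣFin 3 (λ p → bit (does (v Fin.≟ w)) * (bit (does (p Fin.≟ q)) * g (v , p))))
      ≡⟨ ΣFin-cong n (λ v → ΣFin-*ˡ 3 (bit (does (v Fin.≟ w))) (λ p → bit (does (p Fin.≟ q)) * g (v , p))) ⟩
    ΣFin n (λ v → bit (does (v Fin.≟ w)) * ΣFin 3 (λ p → bit (does (p Fin.≟ q)) * g (v , p)))
      ≡⟨ ΣFin-cong n (λ v → cong (bit (does (v Fin.≟ w)) *_) (ΣFin-indicator 3 q (λ p → g (v , p)))) ⟩
    ΣFin n (λ v → bit (does (v Fin.≟ w)) * g (v , q))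
      ≡⟨ ΣFin-indicator n w (λ v → g (v , q)) ⟩
    g (w , q) ∎
    where open ≡-Reasoning

  ΣD-swap : (h : Dart n → Dart n → ℕ) → ΣD (λ d → ΣD (h d)) ≡ ΣD (λ e → ΣD (λ d → h d e))
  ΣD-swap h = begin
    ΣFin n (λ v → ΣFin 3 (λ p → ΣFin n (λ w → ΣFin 3 (λ q → h (v , p) (w , q)))))
      ≡⟨ ΣFin-cong n (λ v → ΣFin-swap 3 n (λ p w → ΣFin 3 (λ q → h (v , p) (w , q)))) ⟩
    ΣFin n (λ v → ΣFin n (λ w → ΣFin 3 (λ p → ΣFin 3 (λ q → h (v , p) (w , q)))))
      ≡⟨ ΣFin-cong n (λ v → ΣFin-cong n (λ w → ΣFin-swap 3 3 (λ p q → h (v , p) (w , q)))) ⟩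
    ΣFin n (λ v → ΣFin n (λ w → ΣFin 3 (λ q → ΣFin 3 (λ p → h (v , p) (w , q)))))
      ≡⟨ ΣFin-swap n n (λ v w → ΣFin 3 (λ q → ΣFin 3 (λ p → h (v , p) (w , q)))) ⟩
    ΣFin n (λ w → ΣFin n (λ v → ΣFin 3 (λ q → ΣFin 3 (λ p → h (v , p) (w , q)))))
      ≡⟨ ΣFin-cong n (λ w → ΣFin-swap n 3 (λ v q → ΣFin 3 (λ p → h (v , p) (w , q)))) ⟩
    ΣFin n (λ w → ΣFin 3 (λ q → ΣFin n (λ v → ΣFin 3 (λ p → h (v , p) (w , q))))) ∎
    where open ≡-Reasoning

  -- Σ_d f (σ d) = Σ_d Σ_e [e = σ d] f e = Σ_e Σ_d [d = σ e] f e = Σ_e f e.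
  ΣD-involution : (σ : Dart n → Dart n) → (∀ d → σ (σ d) ≡ d) →
    (f : Dart n → ℕ) → ΣD (f ∘ σ) ≡ ΣD f
  ΣD-involution σ σ²≡id f = begin
    ΣD (f ∘ σ)
      ≡⟨ ΣD-cong (λ d → ΣD-indicator (σ d) f) ⟨
    ΣD (λ d → ΣD (λ e → bit (does (e ≟ᴰ σ d)) * f e))
      ≡⟨ ΣD-swap (λ d e → bit (does (e ≟ᴰ σ d)) * f e) ⟩
    ΣD (λ e → ΣD (λ d → bit (does (e ≟ᴰ σ d)) * f e))
      ≡⟨ ΣD-cong (λ e → ΣD-cong (λ d →
           cong (λ b → bit b * f e) (does-⇔ (swap e d) (e ≟ᴰ σ d) (d ≟ᴰ σ e)))) ⟩
    ΣD (λ e → ΣD (λ d → bit (does (d ≟ᴰ σ e)) * f e))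
      ≡⟨ ΣD-cong (λ e → ΣD-indicator (σ e) (λ _ → f e)) ⟩
    ΣD f ∎
    where
    open ≡-Reasoning
    swap : ∀ e d → (e ≡ σ d) ⇔ (d ≡ σ e)
    swap e d = mk⇔ (λ e≡σd → trans (sym (σ²≡id d)) (cong σ (sym e≡σd)))
                   (λ d≡σe → trans (sym (σ²≡id e)) (cong σ (sym d≡σe)))

  ΣD-opp : (f : Dart n → ℕ) → ΣD (f ∘ opp G) ≡ ΣD f
  ΣD-opp = ΣD-involution (opp G) (opp-invol G)

  ΣD-complementary : (h : Dart n → Bool) → (∀ d → bit (h d) + bit (h (opp G d)) ≡ 1) →
    ΣD (bit ∘ h) + ΣD (bit ∘ h) ≡ n * 3
  ΣD-complementary h h+h∘opp≡1 = begin
    ΣD (bit ∘ h) + ΣD (bit ∘ h)              ≡⟨ cong (ΣD (bit ∘ h) +_) (ΣD-opp (bit ∘ h)) ⟨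
    ΣD (bit ∘ h) + ΣD (bit ∘ h ∘ opp G)      ≡⟨ ΣD-+ (bit ∘ h) (bit ∘ h ∘ opp G) ⟨
    ΣD (λ d → bit (h d) + bit (h (opp G d))) ≡⟨ ΣD-cong h+h∘opp≡1 ⟩
    ΣD (λ _ → 1)                             ≡⟨ ΣD-const 1 ⟩
    n * 3                                    ∎
    where open ≡-Reasoning

  canonical : Dart n → Bool
  canonical d = ⌊ toℕ (proj₁ d) <? toℕ (proj₁ (opp G d)) ⌋

  canonical-opp : ∀ d → bit (canonical d) + bit (canonical (opp G d)) ≡ 1
  canonical-opp d with toℕ (proj₁ d) <? toℕ (proj₁ (opp G d))
                     | toℕ (proj₁ (opp G d)) <? toℕ (proj₁ (opp G (opp G d)))
  ... | yes u<w | yes w<u rewrite opp-invol G d = ⊥-elim (<-asym u<w w<u)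
  ... | yes _   | no _  = refl
  ... | no _    | yes _ = refl
  ... | no u≮w  | no w≮u rewrite opp-invol G d =
    ⊥-elim (no-loop G d (Fin.toℕ-injective (≤-antisym (≮⇒≥ u≮w) (≮⇒≥ w≮u))))

  canonical⇒¬canonical-opp : ∀ {d} → canonical d ≡ true → canonical (opp G d) ≡ false
  canonical⇒¬canonical-opp {d} c with canonical (opp G d) | canonical-opp d
  ... | false | _ = refl
  ... | true  | sum rewrite c with sum
  ...   | ()

  ¬canonical⇒canonical-opp : ∀ {d} → canonical d ≡ false → canonical (opp G d) ≡ true
  ¬canonical⇒canonical-opp {d} c with canonical (opp G d) | canonical-opp d
  ... | true  | _ = refl
  ... | false | sum rewrite c with sum
  ...   | ()

  handshake : ΣD (bit ∘ canonical) + ΣD (bit ∘ canonical) ≡ n * 3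
  handshake = ΣD-complementary canonical canonical-opp

  private
    singleton-if : (Dart n → Bool) → Dart n → List (Dart n)
    singleton-if h d = if h d then d ∷ [] else []

    length-singleton-if : ∀ h d → length (singleton-if h d) ≡ bit (h d)
    length-singleton-if h d with h d
    ... | true  = refl
    ... | false = refl

    ∈-singleton-if⁻ : ∀ h d {x} → x ∈ₗ singleton-if h d → x ≡ d × h d ≡ true
    ∈-singleton-if⁻ h d x∈ with h d in hd
    ∈-singleton-if⁻ h d (here refl) | true = refl , refl

    dartsAt-with : (Dart n → Bool) → Fin n → List (Dart n)
    dartsAt-with h v = concatFin 3 (λ q → singleton-if h (v , q))

  dartsWith : (Dart n → Bool) → List (Dart n)
  dartsWith h = concatFin n (dartsAt-with h)

  length-dartsWith : ∀ h → length (dartsWith h) ≡ ΣD (bit ∘ h)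
  length-dartsWith h = trans (length-concatFin n (dartsAt-with h))
    (ΣFin-cong n (λ v → trans (length-concatFin 3 (λ q → singleton-if h (v , q)))
                               (ΣFin-cong 3 (λ q → length-singleton-if h (v , q)))))

  ∈-dartsWith⁺ : ∀ h d → h d ≡ true → d ∈ₗ dartsWith h
  ∈-dartsWith⁺ h (v , q) hd =
    ∈-concatFin⁺ n (dartsAt-with h) v (∈-concatFin⁺ 3 (λ q → singleton-if h (v , q)) q singleton)
    where
    singleton : (v , q) ∈ₗ singleton-if h (v , q)
    singleton rewrite hd = here refl

  ∈-dartsWith⁻ : ∀ h {d} → d ∈ₗ dartsWith h → h d ≡ true
  ∈-dartsWith⁻ h d∈ with ∈-concatFin⁻ n (dartsAt-with h) d∈
  ... | v , d∈ᵥ with ∈-concatFin⁻ 3 (λ q → singleton-if h (v , q)) d∈ᵥ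
  ...   | q , d∈ᵥq with ∈-singleton-if⁻ h (v , q) d∈ᵥq
  ...     | refl , hd = hd

  dartsWith-unique : ∀ h → Unique (dartsWith h)
  dartsWith-unique h = AllPairs-concatFin n (dartsAt-with h)
    (λ v → AllPairs-concatFin 3 (λ q → singleton-if h (v , q)) (λ q → singleton-unique (v , q))
       (λ i j i≢j x∈ y∈ x≡y → i≢j (cong proj₂ (trans (sym (proj₁ (∈-singleton-if⁻ h (v , i) x∈)))
                                                  (trans x≡y (proj₁ (∈-singleton-if⁻ h (v , j) y∈)))))))
    (λ v w v≢w x∈ y∈ x≡y → v≢w (trans (sym (tail-vertex x∈)) (trans (cong proj₁ x≡y) (tail-vertex y∈))))
    where
    singleton-unique : ∀ d → Unique (singleton-if h d)
    singleton-unique d with h d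
    ... | true  = [] ∷ []
    ... | false = []
    tail-vertex : ∀ {v x} → x ∈ₗ dartsAt-with h v → proj₁ x ≡ v
    tail-vertex {v} x∈ with ∈-concatFin⁻ 3 (λ q → singleton-if h (v , q)) x∈
    ... | q , x∈q with ∈-singleton-if⁻ h (v , q) x∈q
    ...   | refl , _ = refl

data Role : Set where
  terminal : Role
  evenTie  : Fin 3 → Role
  oddTie   : Fin 3 → Role

role : Fin 8 → Role
role fz                                     = terminal
role (fs fz)                                = evenTie fz
role (fs (fs fz))                           = oddTie fz
role (fs (fs (fs fz)))                      = evenTie (fs fz)
role (fs (fs (fs (fs fz))))                 = oddTie (fs fz)
role (fs (fs (fs (fs (fs fz)))))            = evenTie (fs (fs fz))
role (fs (fs (fs (fs (fs (fs fz))))))       = oddTie (fs (fs fz))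
role (fs (fs (fs (fs (fs (fs (fs fz))))))) = terminal

role-evenIx : ∀ p → role (evenIx p) ≡ evenTie p
role-evenIx fz           = refl
role-evenIx (fs fz)      = refl
role-evenIx (fs (fs fz)) = refl

role-oddIx : ∀ p → role (oddIx p) ≡ oddTie p
role-oddIx fz           = refl
role-oddIx (fs fz)      = refl
role-oddIx (fs (fs fz)) = refl

last8 : Fin 8
last8 = fs (fs (fs (fs (fs (fs (fs fz))))))

prev8 : Fin 8 → Fin 8
prev8 fz     = last8
prev8 (fs k) = inject₁ k

prev8-next8 : ∀ k → prev8 (next8 k) ≡ k
prev8-next8 fz                                     = refl
prev8-next8 (fs fz)                                = refl
prev8-next8 (fs (fs fz))                           = refl
prev8-next8 (fs (fs (fs fz)))                      = refl
prev8-next8 (fs (fs (fs (fs fz))))                 = refl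
prev8-next8 (fs (fs (fs (fs (fs fz)))))            = refl
prev8-next8 (fs (fs (fs (fs (fs (fs fz))))))       = refl
prev8-next8 (fs (fs (fs (fs (fs (fs (fs fz))))))) = refl

next8-prev8-inner : ∀ k → role k ≢ terminal → next8 (prev8 k) ≡ k
next8-prev8-inner fz                                     r = ⊥-elim (r refl)
next8-prev8-inner (fs fz)                                _ = refl
next8-prev8-inner (fs (fs fz))                           _ = refl
next8-prev8-inner (fs (fs (fs fz)))                      _ = refl
next8-prev8-inner (fs (fs (fs (fs fz))))                 _ = refl
next8-prev8-inner (fs (fs (fs (fs (fs fz)))))            _ = refl
next8-prev8-inner (fs (fs (fs (fs (fs (fs fz))))))       _ = refl
next8-prev8-inner (fs (fs (fs (fs (fs (fs (fs fz))))))) r = ⊥-elim (r refl)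

prev8-≢ : ∀ k → prev8 k ≢ k
prev8-≢ fz                                     ()
prev8-≢ (fs fz)                                ()
prev8-≢ (fs (fs fz))                           ()
prev8-≢ (fs (fs (fs fz)))                      ()
prev8-≢ (fs (fs (fs (fs fz))))                 ()
prev8-≢ (fs (fs (fs (fs (fs fz)))))            ()
prev8-≢ (fs (fs (fs (fs (fs (fs fz))))))       ()
prev8-≢ (fs (fs (fs (fs (fs (fs (fs fz))))))) ()

evenIx-injective : ∀ {p q} → evenIx p ≡ evenIx q → p ≡ q
evenIx-injective {p} {q} eq with trans (sym (role-evenIx p)) (trans (cong role eq) (role-evenIx q))
... | refl = refl

oddIx-injective : ∀ {p q} → oddIx p ≡ oddIx q → p ≡ q
oddIx-injective {p} {q} eq with trans (sym (role-oddIx p)) (trans (cong role eq) (role-oddIx q))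
... | refl = refl

evenIx≢oddIx : ∀ {p q} → evenIx p ≢ oddIx q
evenIx≢oddIx {p} {q} eq with trans (sym (role-evenIx p)) (trans (cong role eq) (role-oddIx q))
... | ()

evenIx-inner : ∀ p → role (evenIx p) ≢ terminal
evenIx-inner p eq with trans (sym (role-evenIx p)) eq
... | ()

oddIx-inner : ∀ p → role (oddIx p) ≢ terminal
oddIx-inner p eq with trans (sym (role-oddIx p)) eq
... | ()

next8-evenIx : ∀ p → next8 (evenIx p) ≡ oddIx p
next8-evenIx fz           = refl
next8-evenIx (fs fz)      = refl
next8-evenIx (fs (fs fz)) = refl

prev8-oddIx : ∀ p → prev8 (oddIx p) ≡ evenIx p
prev8-oddIx fz           = refl
prev8-oddIx (fs fz)      = refl
prev8-oddIx (fs (fs fz)) = refl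

module Paths {n : ℕ} (G : CubicMap n) where

  Incident : EI n → VI n → Set
  Incident e z = proj₁ (ends G e) ≡ z ⊎ proj₂ (ends G e) ≡ z

  Joins⇒Incident₁ : ∀ {e x y} → Joins G e x y → Incident e x
  Joins⇒Incident₁ (inj₁ eq) = inj₁ (cong proj₁ eq)
  Joins⇒Incident₁ (inj₂ eq) = inj₂ (cong proj₂ eq)

  Joins⇒Incident₂ : ∀ {e x y} → Joins G e x y → Incident e y
  Joins⇒Incident₂ (inj₁ eq) = inj₂ (cong proj₂ eq)
  Joins⇒Incident₂ (inj₂ eq) = inj₁ (cong proj₁ eq)

  Incident-Joins : ∀ {e x y z} → Joins G e x y → Incident e z → z ≡ x ⊎ z ≡ y
  Incident-Joins (inj₁ eq) (inj₁ i) = inj₁ (trans (sym i) (cong proj₁ eq))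
  Incident-Joins (inj₁ eq) (inj₂ i) = inj₂ (trans (sym i) (cong proj₂ eq))
  Incident-Joins (inj₂ eq) (inj₁ i) = inj₂ (trans (sym i) (cong proj₁ eq))
  Incident-Joins (inj₂ eq) (inj₂ i) = inj₁ (trans (sym i) (cong proj₂ eq))

  head∈ : ∀ {x y} (w : Walk G x y) → x ∈ₗ wverts w
  head∈ (nil x)      = here refl
  head∈ (cons e j w) = here refl

  last∈ : ∀ {x y} (w : Walk G x y) → y ∈ₗ wverts w
  last∈ (nil x)      = here refl
  last∈ (cons e j w) = there (last∈ w)

  incident∈wverts : ∀ {x y e z} (w : Walk G x y) → e ∈ₗ wedges w → Incident e z → z ∈ₗ wverts w
  incident∈wverts (cons e j w) (here refl) i with Incident-Joins j i
  ... | inj₁ refl = here refl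
  ... | inj₂ refl = there (head∈ w)
  incident∈wverts (cons e j w) (there e∈) i = there (incident∈wverts w e∈ i)

  private
    ∉-head : ∀ {x : VI n} {xs} → All (x ≢_) xs → x ∈ₗ xs → ⊥
    ∉-head x∉ x∈ = All.lookup x∉ x∈ refl

  closed-path-empty : ∀ {x e} (w : Walk G x x) → Unique (wverts w) → e ∈ₗ wedges w → ⊥
  closed-path-empty (cons e j w) (x∉ ∷ _) _ = ∉-head x∉ (last∈ w)

  source-edge-unique : ∀ {x y e e′} (w : Walk G x y) → Unique (wverts w) →
    e ∈ₗ wedges w → e′ ∈ₗ wedges w → Incident e x → Incident e′ x → e ≡ e′
  source-edge-unique (cons _ _ w) _        (here refl) (here refl) _ _  = refl
  source-edge-unique (cons _ _ w) (x∉ ∷ _) (here refl) (there e′∈) _ i′ =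
    ⊥-elim (∉-head x∉ (incident∈wverts w e′∈ i′))
  source-edge-unique (cons _ _ w) (x∉ ∷ _) (there e∈)  _           i _  =
    ⊥-elim (∉-head x∉ (incident∈wverts w e∈ i))

  target-edge-unique : ∀ {x y e e′} (w : Walk G x y) → Unique (wverts w) →
    e ∈ₗ wedges w → e′ ∈ₗ wedges w → Incident e y → Incident e′ y → e ≡ e′
  target-edge-unique (cons _ _ w) _ (here refl) (here refl) _ _ = refl
  target-edge-unique (cons _ j w) (x∉ ∷ u) (here refl) (there e′∈) i _ with Incident-Joins j i
  ... | inj₁ refl = ⊥-elim (∉-head x∉ (last∈ w))
  ... | inj₂ refl = ⊥-elim (closed-path-empty w u e′∈)
  target-edge-unique (cons _ j w) (x∉ ∷ u) (there e∈) (here refl) _ i′ with Incident-Joins j i′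
  ... | inj₁ refl = ⊥-elim (∉-head x∉ (last∈ w))
  ... | inj₂ refl = ⊥-elim (closed-path-empty w u e∈)
  target-edge-unique (cons _ _ w) (_ ∷ u) (there e∈) (there e′∈) i i′ = target-edge-unique w u e∈ e′∈ i i′

  private
    two-below-first : ∀ {x y′ y e₀ e e′ z} (j : Joins G e₀ x y′) (w : Walk G y′ y) →
      Unique (x ∷ wverts w) → Incident e₀ z → e ∈ₗ wedges w → e′ ∈ₗ wedges w → e ≢ e′ →
      Incident e z → Incident e′ z → ⊥
    two-below-first j w (x∉ ∷ u) i₀ e∈ e′∈ e≢e′ i i′ with Incident-Joins j i₀
    ... | inj₁ refl = ∉-head x∉ (incident∈wverts w e∈ i)
    ... | inj₂ refl = e≢e′ (source-edge-unique w u e∈ e′∈ i i′)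

  at-most-two-incident : ∀ {x y e₁ e₂ e₃ z} (w : Walk G x y) → Unique (wverts w) →
    e₁ ∈ₗ wedges w → e₂ ∈ₗ wedges w → e₃ ∈ₗ wedges w →
    e₁ ≢ e₂ → e₁ ≢ e₃ → e₂ ≢ e₃ → Incident e₁ z → Incident e₂ z → Incident e₃ z → ⊥
  at-most-two-incident (cons _ j w) u (here refl) (here refl) _ ≢₁₂ _ _ _ _ _ = ≢₁₂ refl
  at-most-two-incident (cons _ j w) u (here refl) (there _) (here refl) _ ≢₁₃ _ _ _ _ = ≢₁₃ refl
  at-most-two-incident (cons _ j w) u (here refl) (there e₂∈) (there e₃∈) _ _ ≢₂₃ i₁ i₂ i₃ =
    two-below-first j w u i₁ e₂∈ e₃∈ ≢₂₃ i₂ i₃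
  at-most-two-incident (cons _ j w) u (there _) (here refl) (here refl) _ _ ≢₂₃ _ _ _ = ≢₂₃ refl
  at-most-two-incident (cons _ j w) u (there e₁∈) (here refl) (there e₃∈) _ ≢₁₃ _ i₁ i₂ i₃ =
    two-below-first j w u i₂ e₁∈ e₃∈ ≢₁₃ i₁ i₃
  at-most-two-incident (cons _ j w) u (there e₁∈) (there e₂∈) (here refl) ≢₁₂ _ _ i₁ i₂ i₃ =
    two-below-first j w u i₃ e₁∈ e₂∈ ≢₁₂ i₁ i₂
  at-most-two-incident (cons _ j w) (_ ∷ u) (there e₁∈) (there e₂∈) (there e₃∈) ≢₁₂ ≢₁₃ ≢₂₃ i₁ i₂ i₃ =
    at-most-two-incident w u e₁∈ e₂∈ e₃∈ ≢₁₂ ≢₁₃ ≢₂₃ i₁ i₂ i₃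

  source-edge : ∀ {x y} (w : Walk G x y) → 1 ≤ length (wedges w) →
    ∃[ e ] (e ∈ₗ wedges w × Incident e x)
  source-edge (cons e j w) _ = e , here refl , Joins⇒Incident₁ j

  target-edge : ∀ {x y} (w : Walk G x y) → 1 ≤ length (wedges w) →
    ∃[ e ] (e ∈ₗ wedges w × Incident e y)
  target-edge (cons e j (nil _))        _ = e , here refl , Joins⇒Incident₂ j
  target-edge (cons e j (cons e′ j′ w)) _ with target-edge (cons e′ j′ w) (s≤s z≤n)
  ... | e″ , e″∈ , i = e″ , there e″∈ , i

  inner-vertex-two-edges : ∀ {x y z} (w : Walk G x y) → Unique (wverts w) → z ∈ₗ wverts w →
    z ≢ x → z ≢ y →
    ∃[ e ] ∃[ e′ ] (e ≢ e′ × e ∈ₗ wedges w × e′ ∈ₗ wedges w × Incident e z × Incident e′ z)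
  inner-vertex-two-edges (nil x) _ (here refl) z≢x _ = ⊥-elim (z≢x refl)
  inner-vertex-two-edges (cons _ _ w) _ (here refl) z≢x _ = ⊥-elim (z≢x refl)
  inner-vertex-two-edges (cons _ _ (nil _)) _ (there (here refl)) _ z≢y = ⊥-elim (z≢y refl)
  inner-vertex-two-edges (cons e j (cons e′ j′ w)) (x∉ ∷ _) (there (here refl)) _ _ =
    e , e′ , e≢e′ , here refl , there (here refl) , Joins⇒Incident₂ j , Joins⇒Incident₁ j′
    where
    e≢e′ : e ≢ e′
    e≢e′ refl with Incident-Joins j′ (Joins⇒Incident₁ j)
    ... | inj₁ refl = ∉-head x∉ (here refl)
    ... | inj₂ refl = ∉-head x∉ (there (head∈ w))
  inner-vertex-two-edges (cons e j (cons e′ j′ w)) (_ ∷ y∉ ∷ u) (there (there z∈)) _ z≢y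
    with inner-vertex-two-edges (cons e′ j′ w) (y∉ ∷ u) (there z∈) (λ { refl → ∉-head y∉ z∈ }) z≢y
  ... | f , f′ , f≢f′ , f∈ , f′∈ , i , i′ = f , f′ , f≢f′ , there f∈ , there f′∈ , i , i′

  TieAt : Fin n → Role → EI n → Set
  TieAt v terminal    e = ⊥
  TieAt v (evenTie p) e = e ≡ evE (v , p)
  TieAt v (oddTie p)  e = e ≡ odE (opp G (v , p))

  incident-cyc : ∀ {e v k} → Incident e (cyc v k) →
    e ≡ cycE v k ⊎ e ≡ cycE v (prev8 k) ⊎ TieAt v (role k) e
  incident-cyc {cycE w j} (inj₁ refl) = inj₁ refl
  incident-cyc {cycE w j} (inj₂ refl) = inj₂ (inj₁ (cong (cycE w) (sym (prev8-next8 j))))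
  incident-cyc {evE (v , p)} (inj₂ refl) rewrite role-evenIx p = inj₂ (inj₂ refl)
  incident-cyc {odE d} (inj₂ refl) with opp G d | opp-invol G d
  ... | v , q | refl rewrite role-oddIx q = inj₂ (inj₂ refl)

  incident-ter : ∀ {e d} → Incident e (ter d) → e ≡ evE d ⊎ e ≡ odE d
  incident-ter {evE d} (inj₁ refl) = inj₁ refl
  incident-ter {odE d} (inj₁ refl) = inj₂ refl
  incident-ter {evE _} (inj₂ ())
  incident-ter {odE _} (inj₂ ())
  incident-ter {cycE _ _} (inj₁ ())
  incident-ter {cycE _ _} (inj₂ ())

  incident-evE-cyc : ∀ v p → Incident (evE (v , p)) (cyc v (evenIx p))
  incident-evE-cyc v p = inj₂ refl

  incident-odE-cyc : ∀ v q → Incident (odE (opp G (v , q))) (cyc v (oddIx q))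
  incident-odE-cyc v q = inj₂ (cong (λ d → cyc (proj₁ d) (oddIx (proj₂ d))) (opp-invol G (v , q)))

double-injective : ∀ x y → x + x ≡ y + y → x ≡ y
double-injective zero    zero    _  = refl
double-injective (suc x) (suc y) eq rewrite +-suc x x | +-suc y y =
  cong suc (double-injective x y (suc-injective (suc-injective eq)))

even-if-triple-even : ∀ n X → X + X ≡ n * 3 → ∃[ m ] n ≡ m + m
even-if-triple-even zero                X             _  = 0 , refl
even-if-triple-even (suc zero)          (suc (suc X)) eq rewrite +-suc X (suc X) | +-suc X X with eq
... | ()
even-if-triple-even (suc (suc n))       (suc (suc (suc X))) eq
  rewrite +-suc X (suc (suc X)) | +-suc X (suc X) | +-suc X X
  with even-if-triple-even n X (suc-injective (suc-injective (suc-injective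
         (suc-injective (suc-injective (suc-injective eq))))))
... | m , refl = suc m , cong suc (sym (+-suc m m))
even-if-triple-even (suc zero)          zero          ()
even-if-triple-even (suc zero)          (suc zero)    ()
even-if-triple-even (suc (suc n))       zero          ()
even-if-triple-even (suc (suc n))       (suc zero)    ()
even-if-triple-even (suc (suc n))       (suc (suc zero)) ()

half-double : ∀ m k → (k * m) * 2 / 2 ≡ k * m
half-double m k = m*n/n≡m (k * m) 2

module CubicCounts {n : ℕ} (G : CubicMap n) where
  open Darts G

  n-even : ∃[ m ] n ≡ m + m
  n-even = even-if-triple-even n (ΣD (bit ∘ canonical)) handshake

  numEdges-double : numEdges n + numEdges n ≡ n * 3
  numEdges-double with n-even
  ... | m , refl = begin
    3 * (m + m) / 2 + 3 * (m + m) / 2 ≡⟨ cong (λ x → x / 2 + x / 2) (double m 3) ⟩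
    (3 * m) * 2 / 2 + (3 * m) * 2 / 2 ≡⟨ cong₂ _+_ (half-double m 3) (half-double m 3) ⟩
    3 * m + 3 * m                     ≡⟨ regroup m ⟩
    (m + m) * 3                       ∎
    where
    open ≡-Reasoning
    double : ∀ m k → k * (m + m) ≡ (k * m) * 2
    double = solve-∀
    regroup : ∀ m → 3 * m + 3 * m ≡ (m + m) * 3
    regroup = solve-∀

  numPaths-double : numPaths n + numPaths n ≡ n * 2 + n * 3
  numPaths-double with n-even
  ... | m , refl = begin
    (2 * (m + m) + 3 * (m + m)) / 2 + (2 * (m + m) + 3 * (m + m)) / 2
      ≡⟨ cong (λ x → x / 2 + x / 2) (double m) ⟩
    (5 * m) * 2 / 2 + (5 * m) * 2 / 2 ≡⟨ cong₂ _+_ (half-double m 5) (half-double m 5) ⟩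
    5 * m + 5 * m                     ≡⟨ regroup m ⟩
    (m + m) * 2 + (m + m) * 3         ∎
    where
    open ≡-Reasoning
    double : ∀ m → 2 * (m + m) + 3 * (m + m) ≡ (5 * m) * 2
    double = solve-∀
    regroup : ∀ m → 5 * m + 5 * m ≡ (m + m) * 2 + (m + m) * 3
    regroup = solve-∀

-- E: edges, W: total gadget weight, len: solution length, L: size of an independent set.
module _ {n E W len L a : ℕ} (E+E≡3n : E + E ≡ n * 3) (W+3n≡len+L : W + n * 3 ≡ len + L)
         (27n≤2W : n * 24 + n * 3 ≤ 2 * W) (L≤a : L ≤ a) where

  private
    double-bound : 2 * (12 * n + 3 * E) ≡ n * 24 + n * 3 + 2 * (n * 3)
    double-bound = begin
      2 * (12 * n + 3 * E)            ≡⟨ regroup n E ⟩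
      n * 24 + 3 * (E + E)            ≡⟨ cong (λ x → n * 24 + 3 * x) E+E≡3n ⟩
      n * 24 + 3 * (n * 3)            ≡⟨ regroup′ n ⟩
      n * 24 + n * 3 + 2 * (n * 3)    ∎
      where
      open ≡-Reasoning
      regroup : ∀ n E → 2 * (12 * n + 3 * E) ≡ n * 24 + 3 * (E + E)
      regroup = solve-∀
      regroup′ : ∀ n → n * 24 + 3 * (n * 3) ≡ n * 24 + n * 3 + 2 * (n * 3)
      regroup′ = solve-∀

  length-lower-bound : 12 * n + 3 * E ≤ len + a
  length-lower-bound = *-cancelˡ-≤ 2 (begin
    2 * (12 * n + 3 * E)         ≡⟨ double-bound ⟩
    n * 24 + n * 3 + 2 * (n * 3) ≤⟨ +-monoˡ-≤ (2 * (n * 3)) 27n≤2W ⟩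
    2 * W + 2 * (n * 3)          ≡⟨ *-distribˡ-+ 2 W (n * 3) ⟨
    2 * (W + n * 3)              ≡⟨ cong (2 *_) W+3n≡len+L ⟩
    2 * (len + L)                ≤⟨ *-monoʳ-≤ 2 (+-monoʳ-≤ len L≤a) ⟩
    2 * (len + a)                ∎)
    where open ≤-Reasoning

  length-tight : len + a ≡ 12 * n + 3 * E → 2 * W ≤ n * 24 + n * 3 × L ≡ a
  length-tight len+a≡ = 2W≤27n , ≤-antisym L≤a a≤L
    where
    2[len+a]≡ : 2 * (len + a) ≡ n * 24 + n * 3 + 2 * (n * 3)
    2[len+a]≡ = trans (cong (2 *_) len+a≡) double-bound
    2W≤27n : 2 * W ≤ n * 24 + n * 3
    2W≤27n = +-cancelʳ-≤ (2 * (n * 3)) _ _ (begin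
      2 * W + 2 * (n * 3)          ≡⟨ *-distribˡ-+ 2 W (n * 3) ⟨
      2 * (W + n * 3)              ≡⟨ cong (2 *_) W+3n≡len+L ⟩
      2 * (len + L)                ≤⟨ *-monoʳ-≤ 2 (+-monoʳ-≤ len L≤a) ⟩
      2 * (len + a)                ≡⟨ 2[len+a]≡ ⟩
      n * 24 + n * 3 + 2 * (n * 3) ∎)
      where open ≤-Reasoning
    a≤L : a ≤ L
    a≤L = +-cancelˡ-≤ len a L (*-cancelˡ-≤ 2 (begin
      2 * (len + a)                ≡⟨ 2[len+a]≡ ⟩
      n * 24 + n * 3 + 2 * (n * 3) ≤⟨ +-monoˡ-≤ (2 * (n * 3)) 27n≤2W ⟩
      2 * W + 2 * (n * 3)          ≡⟨ *-distribˡ-+ 2 W (n * 3) ⟨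
      2 * (W + n * 3)              ≡⟨ cong (2 *_) W+3n≡len+L ⟩
      2 * (len + L)                ∎))
      where open ≤-Reasoning

_≟ᵛ_ : ∀ {n} → DecidableEquality (VI n)
cyc v k ≟ᵛ cyc w j = map′ (λ { (refl , refl) → refl }) (λ { refl → refl , refl }) (v Fin.≟ w ×-dec k Fin.≟ j)
cyc v k ≟ᵛ ter d   = no (λ ())
ter d   ≟ᵛ cyc v k = no (λ ())
ter d   ≟ᵛ ter d′  = map′ (cong ter) (λ { refl → refl }) (d ≟ᴰ d′)

_≟ᵉ_ : ∀ {n} → DecidableEquality (EI n)
cycE v k ≟ᵉ cycE w j = map′ (λ { (refl , refl) → refl }) (λ { refl → refl , refl }) (v Fin.≟ w ×-dec k Fin.≟ j)
cycE v k ≟ᵉ evE d    = no (λ ())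
cycE v k ≟ᵉ odE d    = no (λ ())
evE d    ≟ᵉ cycE v k = no (λ ())
odE d    ≟ᵉ cycE v k = no (λ ())
evE d    ≟ᵉ odE d′   = no (λ ())
odE d    ≟ᵉ evE d′   = no (λ ())
evE d    ≟ᵉ evE d′   = map′ (cong evE) (λ { refl → refl }) (d ≟ᴰ d′)
odE d    ≟ᵉ odE d′   = map′ (cong odE) (λ { refl → refl }) (d ≟ᴰ d′)

Terminal : ∀ {n} → VI n → Set
Terminal x = InA x ⊎ InB x

terminals : (n : ℕ) → List (VI n)
terminals n = concatFin n (λ v → cyc v fz ∷ cyc v last8 ∷ [])
           ++ concatFin n (λ v → concatFin 3 (λ q → ter (v , q) ∷ []))

length-terminals : ∀ n → length (terminals n) ≡ n * 2 + n * 3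
length-terminals n = trans (length-++ (concatFin n (λ v → cyc v fz ∷ cyc v last8 ∷ [])))
  (cong₂ _+_ (trans (length-concatFin n _) (ΣFin-const n 2))
             (trans (length-concatFin n _)
               (trans (ΣFin-cong n (λ v → length-concatFin 3 (λ q → ter (v , q) ∷ []))) (ΣFin-const n 3))))

∈-terminals : ∀ {n} (x : VI n) → Terminal x → x ∈ₗ terminals n
∈-terminals {n} (cyc v k) (inj₁ (inj₁ k≡0)) with Fin.toℕ-injective {i = k} {j = fz} k≡0
... | refl = ∈-++⁺ˡ (∈-concatFin⁺ n (λ v → cyc v fz ∷ cyc v last8 ∷ []) v (here refl))
∈-terminals {n} (cyc v k) (inj₁ (inj₂ k≡7)) with Fin.toℕ-injective {i = k} {j = last8} k≡7
... | refl = ∈-++⁺ˡ (∈-concatFin⁺ n (λ v → cyc v fz ∷ cyc v last8 ∷ []) v (there (here refl)))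
∈-terminals {n} (ter (v , q)) (inj₂ _) =
  ∈-++⁺ʳ (concatFin n (λ v → cyc v fz ∷ cyc v last8 ∷ []))
    (∈-concatFin⁺ n _ v (∈-concatFin⁺ 3 (λ q → ter (v , q) ∷ []) q (here refl)))

source-terminal : ∀ {n} {G : CubicMap n} (P : ABPath G) → Terminal (src P)
source-terminal P with endsOK P
... | inj₁ (a , _) = inj₁ a
... | inj₂ (b , _) = inj₂ b

target-terminal : ∀ {n} {G : CubicMap n} (P : ABPath G) → Terminal (tgt P)
target-terminal P with endsOK P
... | inj₁ (_ , a) = inj₁ a
... | inj₂ (_ , b) = inj₂ b

endpoints : ∀ {n} {G : CubicMap n} → List (ABPath G) → List (VI n)
endpoints []       = []
endpoints (P ∷ Ps) = src P ∷ tgt P ∷ endpoints Ps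

length-endpoints : ∀ {n} {G : CubicMap n} (Ps : List (ABPath G)) →
  length (endpoints Ps) ≡ length Ps + length Ps
length-endpoints []       = refl
length-endpoints (P ∷ Ps) =
  trans (cong (suc ∘ suc) (length-endpoints Ps)) (cong suc (sym (+-suc (length Ps) (length Ps))))

∈-endpoints⁻ : ∀ {n} {G : CubicMap n} (Ps : List (ABPath G)) {y} → y ∈ₗ endpoints Ps →
  ∃[ Q ] (Q ∈ₗ Ps × (y ≡ src Q ⊎ y ≡ tgt Q))
∈-endpoints⁻ (P ∷ Ps) (here refl)         = P , here refl , inj₁ refl
∈-endpoints⁻ (P ∷ Ps) (there (here refl)) = P , here refl , inj₂ refl
∈-endpoints⁻ (P ∷ Ps) (there (there y∈)) with ∈-endpoints⁻ Ps y∈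
... | Q , Q∈ , y≡ = Q , there Q∈ , y≡

module Solutions {n : ℕ} (G : CubicMap n) (E' : EdgeSet n) (sol : Solution G E') where
  open Paths G

  paths : List (ABPath G)
  paths = proj₁ sol

  paths-length : length paths ≡ numPaths n
  paths-length = proj₁ (proj₂ sol)

  paths-disjoint : AllPairs (VDisjoint {G = G}) paths
  paths-disjoint = proj₁ (proj₂ (proj₂ sol))

  used⇔on-path : ∀ e → (E' e ≡ true) ⇔ Any (λ P → e ∈ₗ wedges (walk P)) paths
  used⇔on-path = proj₂ (proj₂ (proj₂ sol))

  used⇒on-path : ∀ {e} → E' e ≡ true → ∃[ P ] (P ∈ₗ paths × e ∈ₗ wedges (walk P))
  used⇒on-path used = find (Equivalence.to (used⇔on-path _) used)

  on-path⇒used : ∀ {e P} → P ∈ₗ paths → e ∈ₗ wedges (walk P) → E' e ≡ true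
  on-path⇒used P∈ e∈ = Equivalence.from (used⇔on-path _) (lose P∈ e∈)

  same-path : ∀ {P Q x} → P ∈ₗ paths → Q ∈ₗ paths →
    x ∈ₗ wverts (walk P) → x ∈ₗ wverts (walk Q) → P ≡ Q
  same-path P∈ Q∈ x∈P x∈Q with AllPairs-lookup paths-disjoint P∈ Q∈
  ... | inj₁ P≡Q         = P≡Q
  ... | inj₂ (inj₁ disj) = ⊥-elim (disj _ x∈P x∈Q)
  ... | inj₂ (inj₂ disj) = ⊥-elim (disj _ x∈Q x∈P)

  endpoint∈wverts : (P : ABPath G) → ∀ {y} → (y ≡ src P ⊎ y ≡ tgt P) → y ∈ₗ wverts (walk P)
  endpoint∈wverts P (inj₁ refl) = head∈ (walk P)
  endpoint∈wverts P (inj₂ refl) = last∈ (walk P)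

  endpoints-unique : ∀ Ps → AllPairs (VDisjoint {G = G}) Ps → Unique (endpoints Ps)
  endpoints-unique []       _ = []
  endpoints-unique (P ∷ Ps) (P-disj ∷ disj) =
    (src≢tgt ∷ All.tabulate (apart (head∈ (walk P))))
    ∷ All.tabulate (apart (last∈ (walk P)))
    ∷ endpoints-unique Ps disj
    where
    src≢tgt : src P ≢ tgt P
    src≢tgt refl with source-edge (walk P) (nonTriv P)
    ... | _ , e∈ , _ = closed-path-empty (walk P) (distinct P) e∈
    apart : ∀ {x y} → x ∈ₗ wverts (walk P) → y ∈ₗ endpoints Ps → x ≢ y
    apart x∈ y∈ refl with ∈-endpoints⁻ Ps y∈
    ... | Q , Q∈ , y≡ = All.lookup P-disj Q∈ _ x∈ (endpoint∈wverts Q y≡)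

  -- Pigeonhole: the paths have 2·numPaths = |A| + |B| distinct terminal endpoints.
  terminal⇒endpoint : ∀ x → Terminal x → x ∈ₗ endpoints paths
  terminal⇒endpoint x t with DecMembership._∈?_ _≟ᵛ_ x (endpoints paths)
  ... | yes x∈ = x∈
  ... | no x∉ = ⊥-elim (<-irrefl same-length
    (length-≤-by-matching _≡_ (λ p q → trans p (sym q)) (x ∷ endpoints paths) (terminals n)
      (All.tabulate (λ y∈ x≡y → x∉ (subst (_∈ₗ endpoints paths) (sym x≡y) y∈))
        ∷ endpoints-unique paths paths-disjoint)
      (∈-terminals x t ∷ All.tabulate endpoint-terminal)))
    where
    same-length : length (endpoints paths) ≡ length (terminals n)
    same-length = begin
      length (endpoints paths)    ≡⟨ length-endpoints paths ⟩
      length paths + length paths ≡⟨ cong (λ k → k + k) paths-length ⟩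
      numPaths n + numPaths n     ≡⟨ CubicCounts.numPaths-double G ⟩
      n * 2 + n * 3               ≡⟨ length-terminals n ⟨
      length (terminals n)        ∎
      where open ≡-Reasoning
    endpoint-terminal : ∀ {y} → y ∈ₗ endpoints paths → y ∈ₗ terminals n
    endpoint-terminal y∈ with ∈-endpoints⁻ paths y∈
    ... | Q , _ , inj₁ refl = ∈-terminals _ (source-terminal Q)
    ... | Q , _ , inj₂ refl = ∈-terminals _ (target-terminal Q)

  terminal-on-path⇒end : ∀ {P x} → P ∈ₗ paths → x ∈ₗ wverts (walk P) → Terminal x →
    x ≡ src P ⊎ x ≡ tgt P
  terminal-on-path⇒end P∈ x∈ t with ∈-endpoints⁻ paths (terminal⇒endpoint _ t)
  ... | Q , Q∈ , x≡ with same-path P∈ Q∈ x∈ (endpoint∈wverts Q x≡)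
  ... | refl = x≡

  used-incident⇒on-path : ∀ {P x e} → P ∈ₗ paths → x ∈ₗ wverts (walk P) → E' e ≡ true →
    Incident e x → e ∈ₗ wedges (walk P)
  used-incident⇒on-path P∈ x∈ used i with used⇒on-path used
  ... | Q , Q∈ , e∈ with same-path P∈ Q∈ x∈ (incident∈wverts (walk Q) e∈ i)
  ... | refl = e∈

  terminal-used-edge : ∀ x → Terminal x → ∃[ e ] (Incident e x × E' e ≡ true)
  terminal-used-edge x t with ∈-endpoints⁻ paths (terminal⇒endpoint x t)
  ... | Q , Q∈ , inj₁ refl = let e , e∈ , i = source-edge (walk Q) (nonTriv Q) in e , i , on-path⇒used Q∈ e∈
  ... | Q , Q∈ , inj₂ refl = let e , e∈ , i = target-edge (walk Q) (nonTriv Q) in e , i , on-path⇒used Q∈ e∈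

  terminal-used-edge-unique : ∀ x {e e′} → Terminal x → E' e ≡ true → E' e′ ≡ true →
    Incident e x → Incident e′ x → e ≡ e′
  terminal-used-edge-unique x t used used′ i i′ with used⇒on-path used
  ... | P , P∈ , e∈ with terminal-on-path⇒end P∈ (incident∈wverts (walk P) e∈ i) t
  ...   | inj₁ refl = source-edge-unique (walk P) (distinct P) e∈
                      (used-incident⇒on-path P∈ (incident∈wverts (walk P) e∈ i) used′ i′) i i′
  ...   | inj₂ refl = target-edge-unique (walk P) (distinct P) e∈
                      (used-incident⇒on-path P∈ (incident∈wverts (walk P) e∈ i) used′ i′) i i′

  inner-used-edge-partner : ∀ x {e} → ¬ Terminal x → E' e ≡ true → Incident e x →
    ∃[ e′ ] (e′ ≢ e × Incident e′ x × E' e′ ≡ true)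
  inner-used-edge-partner x {e} ¬t used i with used⇒on-path used
  ... | P , P∈ , e∈
      with inner-vertex-two-edges (walk P) (distinct P) (incident∈wverts (walk P) e∈ i)
             (λ { refl → ¬t (source-terminal P) }) (λ { refl → ¬t (target-terminal P) })
  ...   | e₁ , e₂ , e₁≢e₂ , e₁∈ , e₂∈ , i₁ , i₂ with e₁ ≟ᵉ e
  ...     | yes refl = e₂ , (λ eq → e₁≢e₂ (sym eq)) , i₂ , on-path⇒used P∈ e₂∈
  ...     | no e₁≢e  = e₁ , e₁≢e , i₁ , on-path⇒used P∈ e₁∈

  no-three-used-incident : ∀ x {e₁ e₂ e₃} → E' e₁ ≡ true → E' e₂ ≡ true → E' e₃ ≡ true →
    e₁ ≢ e₂ → e₁ ≢ e₃ → e₂ ≢ e₃ → Incident e₁ x → Incident e₂ x → Incident e₃ x → ⊥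
  no-three-used-incident x used₁ used₂ used₃ ≢₁₂ ≢₁₃ ≢₂₃ i₁ i₂ i₃ with used⇒on-path used₁
  ... | P , P∈ , e₁∈ = at-most-two-incident (walk P) (distinct P) e₁∈
        (used-incident⇒on-path P∈ x∈ used₂ i₂) (used-incident⇒on-path P∈ x∈ used₃ i₃) ≢₁₂ ≢₁₃ ≢₂₃ i₁ i₂ i₃
    where x∈ = incident∈wverts (walk P) e₁∈ i₁

-- The vertex gadget, by exhaustive check

∀-Vec-Bool? : ∀ k {P : Vec Bool k → Set} → (∀ v → Dec (P v)) → Dec (∀ v → P v)
∀-Vec-Bool? zero    P? = map′ (λ { p [] → p }) (λ ∀P → ∀P []) (P? [])
∀-Vec-Bool? (suc k) P? =
  map′ (λ { (Pt , Pf) (true ∷ v) → Pt v ; (Pt , Pf) (false ∷ v) → Pf v })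
       (λ ∀P → (λ v → ∀P (true ∷ v)) , (λ v → ∀P (false ∷ v)))
       (∀-Vec-Bool? k (λ v → P? (true ∷ v)) ×-dec ∀-Vec-Bool? k (λ v → P? (false ∷ v)))

-- The cycle edges v′₁v′₂, …, v′₈v′₁ of a vertex, then its tie edges at v′₂, …, v′₇.
Gadget : Set
Gadget = Vec Bool 14

pattern gadget c₀ c₁ c₂ c₃ c₄ c₅ c₆ c₇ t₁ t₂ t₃ t₄ t₅ t₆ =
  c₀ ∷ c₁ ∷ c₂ ∷ c₃ ∷ c₄ ∷ c₅ ∷ c₆ ∷ c₇ ∷ t₁ ∷ t₂ ∷ t₃ ∷ t₄ ∷ t₅ ∷ t₆ ∷ []

zeroOrTwo : Bool → Bool → Bool → Bool
zeroOrTwo false false false = true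
zeroOrTwo true  true  false = true
zeroOrTwo true  false true  = true
zeroOrTwo false true  true  = true
zeroOrTwo _     _     _     = false

-- Local constraints of a solution: v′₁ and v′₈ have degree one, v′₂ … v′₇ degree zero
-- or two, and if v′₈v′₁ is unused the path from v′₁ runs around the cycle, using no tie.
feasible : Gadget → Bool
feasible (gadget c₀ c₁ c₂ c₃ c₄ c₅ c₆ c₇ t₁ t₂ t₃ t₄ t₅ t₆) =
  (c₀ xor c₇) ∧ (c₆ xor c₇)
  ∧ zeroOrTwo c₁ c₀ t₁ ∧ zeroOrTwo c₂ c₁ t₂ ∧ zeroOrTwo c₃ c₂ t₃
  ∧ zeroOrTwo c₄ c₃ t₄ ∧ zeroOrTwo c₅ c₄ t₅ ∧ zeroOrTwo c₆ c₅ t₆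
  ∧ (c₇ ∨ not (t₁ ∨ t₂ ∨ t₃ ∨ t₄ ∨ t₅ ∨ t₆))

ties-used : Gadget → Bool
ties-used (gadget _ _ _ _ _ _ _ _ t₁ t₂ t₃ t₄ t₅ t₆) = t₁ ∨ t₂ ∨ t₃ ∨ t₄ ∨ t₅ ∨ t₆

closing : Gadget → Bool
closing (gadget _ _ _ _ _ _ _ c₇ _ _ _ _ _ _) = c₇

cycleCost : Gadget → ℕ
cycleCost (gadget c₀ c₁ c₂ c₃ c₄ c₅ c₆ c₇ _ _ _ _ _ _) =
  wt c₀ 2 + (wt c₁ 1 + (wt c₂ 2 + (wt c₃ 1 + (wt c₄ 2 + (wt c₅ 1 + (wt c₆ 2 + (wt c₇ 12 + 0)))))))

ties : Gadget → ℕ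
ties (gadget _ _ _ _ _ _ _ _ t₁ t₂ t₃ t₄ t₅ t₆) =
  bit t₁ + bit t₂ + (bit t₃ + bit t₄ + (bit t₅ + bit t₆ + 0))

-- An unused closing edge v′₈v′₁ puts v into the independent set.
weight : Gadget → ℕ
weight g = cycleCost g + bit (not (closing g))

-- The gadget of a vertex in the solution built from an independent set (s = v is in it)
-- whose B-paths through the tie pairs at v′₂v′₃, v′₄v′₅, v′₆v′₇ are r₀, r₁, r₂.
canonicalGadget : Bool → Bool → Bool → Bool → Gadget
canonicalGadget s r₀ r₁ r₂ = gadget s (s ∨ r₀) s (s ∨ r₁) s (s ∨ r₂) s (not s) r₀ r₀ r₁ r₁ r₂ r₂

tieBits : Gadget → Bool × Bool × Bool
tieBits (gadget _ _ _ _ _ _ _ _ t₁ _ t₃ _ t₅ _) = t₁ , t₃ , t₅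

canonicalOf : Gadget → Gadget
canonicalOf g with tieBits g
... | t₁ , t₃ , t₅ = canonicalGadget (not (closing g)) t₁ t₃ t₅

gadget-bound : ∀ g → T (feasible g) → 12 * 2 + ties g ≤ 2 * weight g
gadget-bound = toWitness {a? = ∀-Vec-Bool? 14 (λ g → T? (feasible g) →-dec (12 * 2 + ties g ≤? 2 * weight g))} tt

gadget-tight : ∀ g → T (feasible g) → 2 * weight g ≡ 12 * 2 + ties g → g ≡ canonicalOf g
gadget-tight = toWitness {a? = ∀-Vec-Bool? 14 (λ g →
  T? (feasible g) →-dec (2 * weight g ≟ 12 * 2 + ties g) →-dec (≡-dec Bool._≟_ g (canonicalOf g)))} tt

-- Every solution is locally feasible

module SolutionGadgets {n : ℕ} (G : CubicMap n) (E' : EdgeSet n) (sol : Solution G E') where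
  open Darts G
  open Paths G
  open Solutions G E' sol

  terminal-degree-one : ∀ z {e₁ e₂} → Terminal z → e₁ ≢ e₂ → Incident e₁ z → Incident e₂ z →
    (∀ {e} → Incident e z → e ≡ e₁ ⊎ e ≡ e₂) → T (E' e₁ xor E' e₂)
  terminal-degree-one z {e₁} {e₂} t e₁≢e₂ i₁ i₂ only with E' e₁ in u₁ | E' e₂ in u₂
  ... | true  | true  = e₁≢e₂ (terminal-used-edge-unique z t u₁ u₂ i₁ i₂)
  ... | true  | false = tt
  ... | false | true  = tt
  ... | false | false with terminal-used-edge z t
  ...   | e , i , used with only {e} i
  ...     | inj₁ refl = true≢false used u₁
  ...     | inj₂ refl = true≢false used u₂

  no-lonely-used-edge : ∀ z {e} → ¬ Terminal z → E' e ≡ true → Incident e z →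
    (∀ {e′} → Incident e′ z → e′ ≢ e → E' e′ ≡ false) → ⊥
  no-lonely-used-edge z ¬t used i others with inner-used-edge-partner z ¬t used i
  ... | e′ , e′≢e , i′ , used′ = true≢false used′ (others i′ e′≢e)

  inner-degree-zero-or-two : ∀ z {e₁ e₂ e₃} → ¬ Terminal z → e₁ ≢ e₂ → e₁ ≢ e₃ → e₂ ≢ e₃ →
    Incident e₁ z → Incident e₂ z → Incident e₃ z →
    (∀ {e} → Incident e z → e ≡ e₁ ⊎ e ≡ e₂ ⊎ e ≡ e₃) → T (zeroOrTwo (E' e₁) (E' e₂) (E' e₃))
  inner-degree-zero-or-two z {e₁} {e₂} {e₃} ¬t ≢₁₂ ≢₁₃ ≢₂₃ i₁ i₂ i₃ only
    with E' e₁ in u₁ | E' e₂ in u₂ | E' e₃ in u₃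
  ... | false | false | false = tt
  ... | true  | true  | false = tt
  ... | true  | false | true  = tt
  ... | false | true  | true  = tt
  ... | true  | true  | true  = no-three-used-incident z u₁ u₂ u₃ ≢₁₂ ≢₁₃ ≢₂₃ i₁ i₂ i₃
  ... | true  | false | false = no-lonely-used-edge z ¬t u₁ i₁ λ {e} i e≢ → case only {e} i of λ where
        (inj₁ refl)        → ⊥-elim (e≢ refl)
        (inj₂ (inj₁ refl)) → u₂
        (inj₂ (inj₂ refl)) → u₃
  ... | false | true  | false = no-lonely-used-edge z ¬t u₂ i₂ λ {e} i e≢ → case only {e} i of λ where
        (inj₁ refl)        → u₁
        (inj₂ (inj₁ refl)) → ⊥-elim (e≢ refl)
        (inj₂ (inj₂ refl)) → u₃
  ... | false | false | true  = no-lonely-used-edge z ¬t u₃ i₃ λ {e} i e≢ → case only {e} i of λ where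
        (inj₁ refl)        → u₁
        (inj₂ (inj₁ refl)) → u₂
        (inj₂ (inj₂ refl)) → ⊥-elim (e≢ refl)

  private
    cyc-terminal⇒role : ∀ {v : Fin n} {k} → Terminal (cyc v k) → role k ≡ terminal
    cyc-terminal⇒role {k = k} (inj₁ (inj₁ k≡0)) with Fin.toℕ-injective {i = k} {j = fz} k≡0
    ... | refl = refl
    cyc-terminal⇒role {k = k} (inj₁ (inj₂ k≡7)) with Fin.toℕ-injective {i = k} {j = last8} k≡7
    ... | refl = refl

    A∩B=∅ : ∀ {y : VI n} → InA y → InB y → ⊥
    A∩B=∅ {cyc _ _} _ ()

    zeroOrTwo-step : ∀ {a b c} → T (zeroOrTwo a b c) → b ≡ true → c ≡ false → a ≡ true
    zeroOrTwo-step {true} _ _ _ = refl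
    zeroOrTwo-step {false} {true} {false} () refl refl

    tie-inner : ∀ {v r t} → TieAt v r t → r ≢ terminal
    tie-inner {r = terminal} () _
    tie-inner {r = evenTie _} _ ()
    tie-inner {r = oddTie _}  _ ()

    tie-unique : ∀ {v r e t} → TieAt v r e → TieAt v r t → e ≡ t
    tie-unique {r = evenTie _} refl refl = refl
    tie-unique {r = oddTie _}  refl refl = refl

    cycle≢tie : ∀ {v r t w j} → TieAt v r t → cycE w j ≢ t
    cycle≢tie {r = evenTie _} refl ()
    cycle≢tie {r = oddTie _}  refl ()

  zeroOrTwo-inner : ∀ v k t → TieAt v (role k) t → Incident t (cyc v k) →
    T (zeroOrTwo (E' (cycE v k)) (E' (cycE v (prev8 k))) (E' t))
  zeroOrTwo-inner v k t tie incident-t = inner-degree-zero-or-two (cyc v k)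
    (λ term → tie-inner {v} {role k} {t} tie (cyc-terminal⇒role {v} {k} term))
    (λ eq → prev8-≢ k (cycE-index (sym eq))) (cycle≢tie {v} {role k} {t} tie) (cycle≢tie {v} {role k} {t} tie)
    (inj₁ refl) (inj₂ (cong (cyc v) (next8-prev8-inner k (tie-inner {v} {role k} {t} tie)))) incident-t
    (λ {e} i → case incident-cyc {e} {v} {k} i of λ where
      (inj₁ eq)        → inj₁ eq
      (inj₂ (inj₁ eq)) → inj₂ (inj₁ eq)
      (inj₂ (inj₂ t′)) → inj₂ (inj₂ (tie-unique {v} {role k} {e} {t} t′ tie)))
    where
    cycE-index : ∀ {j j′} → cycE v j ≡ cycE v j′ → j ≡ j′
    cycE-index refl = refl

  zeroOrTwo-evenIx : ∀ v p →
    T (zeroOrTwo (E' (cycE v (evenIx p))) (E' (cycE v (prev8 (evenIx p)))) (E' (evE (v , p))))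
  zeroOrTwo-evenIx v p = zeroOrTwo-inner v (evenIx p) (evE (v , p))
    (subst (λ r → TieAt v r (evE (v , p))) (sym (role-evenIx p)) refl) (incident-evE-cyc v p)

  zeroOrTwo-oddIx : ∀ v p →
    T (zeroOrTwo (E' (cycE v (oddIx p))) (E' (cycE v (prev8 (oddIx p)))) (E' (odE (opp G (v , p)))))
  zeroOrTwo-oddIx v p = zeroOrTwo-inner v (oddIx p) (odE (opp G (v , p)))
    (subst (λ r → TieAt v r (odE (opp G (v , p)))) (sym (role-oddIx p)) refl) (incident-odE-cyc v p)

  first-xor-closing : ∀ v → T (E' (cycE v fz) xor E' (cycE v last8))
  first-xor-closing v = terminal-degree-one (cyc v fz) (inj₁ (inj₁ refl)) (λ ()) (inj₁ refl) (inj₂ refl)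
    (λ {e} i → case incident-cyc {e} {v} {fz} i of λ where
      (inj₁ eq)        → inj₁ eq
      (inj₂ (inj₁ eq)) → inj₂ eq
      (inj₂ (inj₂ ())))

  last-xor-closing : ∀ v → T (E' (cycE v (# 6)) xor E' (cycE v last8))
  last-xor-closing v = terminal-degree-one (cyc v last8) (inj₁ (inj₂ refl)) (λ ()) (inj₂ refl) (inj₁ refl)
    (λ {e} i → case incident-cyc {e} {v} {last8} i of λ where
      (inj₁ eq)        → inj₂ eq
      (inj₂ (inj₁ eq)) → inj₁ eq
      (inj₂ (inj₂ ())))

  tie-pair : ∀ d → T (E' (evE d) xor E' (odE d))
  tie-pair d = terminal-degree-one (ter d) (inj₂ tt) (λ ()) (inj₁ refl) (inj₁ refl) incident-ter

  A-path-avoids-B : ∀ {P x d} → P ∈ₗ paths → x ∈ₗ wverts (walk P) → InA x →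
    ter d ∈ₗ wverts (walk P) → ⊥
  A-path-avoids-B {P} P∈ x∈ x∈A t∈ with endsOK P | terminal-on-path⇒end P∈ t∈ (inj₂ tt)
  ... | inj₁ (a , _) | inj₁ refl = a
  ... | inj₁ (_ , a) | inj₂ refl = a
  ... | inj₂ (b , b′) | _ with terminal-on-path⇒end P∈ x∈ (inj₁ x∈A)
  ...   | inj₁ refl = A∩B=∅ x∈A b
  ...   | inj₂ refl = A∩B=∅ x∈A b′

  -- If v′₈v′₁ is unused, the path leaving v′₁ is an A-path and runs around the whole
  -- cycle: at each v′ₖ the tie edge would lead to a B-terminal.
  unused-closing⇒no-ties : ∀ v → E' (cycE v last8) ≡ false →
    ∀ p → E' (evE (v , p)) ≡ false × E' (odE (opp G (v , p))) ≡ false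
  unused-closing⇒no-ties v closing-unused = ties-unused
    where
    first-used : E' (cycE v fz) ≡ true
    first-used with E' (cycE v fz) | first-xor-closing v
    ... | true | _ = refl
    ... | false | one-used rewrite closing-unused = ⊥-elim one-used
    path₀ = used⇒on-path first-used
    P = proj₁ path₀
    P∈ = proj₁ (proj₂ path₀)
    v₀∈P : cyc v fz ∈ₗ wverts (walk P)
    v₀∈P = incident∈wverts (walk P) (proj₂ (proj₂ path₀)) (inj₁ refl)
    no-B-terminal : ∀ {d} → ter d ∈ₗ wverts (walk P) → ⊥
    no-B-terminal = A-path-avoids-B P∈ v₀∈P (inj₁ refl)
    advance : ∀ {k} → cyc v k ∈ₗ wverts (walk P) → E' (cycE v k) ≡ true → cyc v (next8 k) ∈ₗ wverts (walk P)
    advance x∈ used = incident∈wverts (walk P) (used-incident⇒on-path P∈ x∈ used (inj₁ refl)) (inj₂ refl)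
    unused-B-tie : ∀ {t x d} → x ∈ₗ wverts (walk P) → Incident t x → Incident t (ter d) → E' t ≡ false
    unused-B-tie {t} x∈ i i-ter with E' t in used
    ... | false = refl
    ... | true  = ⊥-elim (no-B-terminal
                    (incident∈wverts (walk P) (used-incident⇒on-path P∈ x∈ used i) i-ter))
    around : ∀ p → cyc v (evenIx p) ∈ₗ wverts (walk P) → E' (cycE v (prev8 (evenIx p))) ≡ true →
      (E' (evE (v , p)) ≡ false × E' (odE (opp G (v , p))) ≡ false)
      × E' (cycE v (oddIx p)) ≡ true × cyc v (next8 (oddIx p)) ∈ₗ wverts (walk P)
    around p x∈ prev-used = (ev-unused , od-unused) , od-used , advance y∈ od-used
      where
      ev-unused = unused-B-tie x∈ (incident-evE-cyc v p) (inj₁ refl)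
      ev-used = zeroOrTwo-step (zeroOrTwo-evenIx v p) prev-used ev-unused
      y∈ = subst (λ k → cyc v k ∈ₗ wverts (walk P)) (next8-evenIx p) (advance x∈ ev-used)
      od-unused = unused-B-tie y∈ (incident-odE-cyc v p) (inj₁ refl)
      od-used = zeroOrTwo-step (zeroOrTwo-oddIx v p)
        (subst (λ k → E' (cycE v k) ≡ true) (sym (prev8-oddIx p)) ev-used) od-unused
    around₀ = around fz (advance v₀∈P first-used) first-used
    around₁ = around (fs fz) (proj₂ (proj₂ around₀)) (proj₁ (proj₂ around₀))
    around₂ = around (fs (fs fz)) (proj₂ (proj₂ around₁)) (proj₁ (proj₂ around₁))
    ties-unused : ∀ p → E' (evE (v , p)) ≡ false × E' (odE (opp G (v , p))) ≡ false
    ties-unused fz           = proj₁ around₀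
    ties-unused (fs fz)      = proj₁ around₁
    ties-unused (fs (fs fz)) = proj₁ around₂

  gadgetAt : Fin n → Gadget
  gadgetAt v = gadget
    (E' (cycE v (# 0))) (E' (cycE v (# 1))) (E' (cycE v (# 2))) (E' (cycE v (# 3)))
    (E' (cycE v (# 4))) (E' (cycE v (# 5))) (E' (cycE v (# 6))) (E' (cycE v (# 7)))
    (E' (evE (v , # 0))) (E' (odE (opp G (v , # 0))))
    (E' (evE (v , # 1))) (E' (odE (opp G (v , # 1))))
    (E' (evE (v , # 2))) (E' (odE (opp G (v , # 2))))

  private
    _&_ : ∀ {a b} → T a → T b → T (a ∧ b)
    _&_ {true} _ q = q
    infixr 4 _&_

  closing-or-no-ties : ∀ v → T (closing (gadgetAt v) ∨ not (ties-used (gadgetAt v)))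
  closing-or-no-ties v with E' (cycE v last8) in closing-used
  ... | true  = tt
  ... | false with unused-closing⇒no-ties v closing-used
  ...   | ties-unused
    rewrite proj₁ (ties-unused (# 0)) | proj₂ (ties-unused (# 0))
          | proj₁ (ties-unused (# 1)) | proj₂ (ties-unused (# 1))
          | proj₁ (ties-unused (# 2)) | proj₂ (ties-unused (# 2)) = tt

  feasible-gadgetAt : ∀ v → T (feasible (gadgetAt v))
  feasible-gadgetAt v =
    first-xor-closing v & last-xor-closing v
    & zeroOrTwo-evenIx v (# 0) & zeroOrTwo-oddIx v (# 0)
    & zeroOrTwo-evenIx v (# 1) & zeroOrTwo-oddIx v (# 1)
    & zeroOrTwo-evenIx v (# 2) & zeroOrTwo-oddIx v (# 2)
    & closing-or-no-ties v

  selected : Subset n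
  selected = tabulate (not ∘ closing ∘ gadgetAt)

  selected⇒closing-unused : ∀ {v} → v ∈ selected → E' (cycE v last8) ≡ false
  selected⇒closing-unused {v} v∈ with E' (cycE v last8) | trans (sym (lookup∘tabulate (not ∘ closing ∘ gadgetAt) v)) ([]=⇒lookup v∈)
  ... | false | _ = refl

  evE-at-selected : ∀ d → proj₁ d ∈ selected → E' (evE d) ≡ false
  evE-at-selected (v , p) v∈ = proj₁ (unused-closing⇒no-ties v (selected⇒closing-unused v∈) p)

  odE-at-selected : ∀ d → proj₁ (opp G d) ∈ selected → E' (odE d) ≡ false
  odE-at-selected d w∈ with opp G d | opp-invol G d
  ... | w , q | refl = proj₂ (unused-closing⇒no-ties w (selected⇒closing-unused w∈) q)

  selected-independent : Independent G selected
  selected-independent d v∈ w∈ = subst T both-unused (tie-pair d)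
    where
    both-unused : (E' (evE d) xor E' (odE d)) ≡ false
    both-unused rewrite evE-at-selected d v∈ | odE-at-selected d w∈ = refl

  ΣFin-ties : ΣFin n (ties ∘ gadgetAt) ≡ n * 3
  ΣFin-ties = begin
    ΣD (λ d → bit (E' (evE d)) + bit (E' (odE (opp G d))))
      ≡⟨ ΣD-+ (bit ∘ E' ∘ evE) (bit ∘ E' ∘ odE ∘ opp G) ⟩
    ΣD (bit ∘ E' ∘ evE) + ΣD (bit ∘ E' ∘ odE ∘ opp G)
      ≡⟨ cong (ΣD (bit ∘ E' ∘ evE) +_) (ΣD-opp (bit ∘ E' ∘ odE)) ⟩
    ΣD (bit ∘ E' ∘ evE) + ΣD (bit ∘ E' ∘ odE)
      ≡⟨ ΣD-+ (bit ∘ E' ∘ evE) (bit ∘ E' ∘ odE) ⟨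
    ΣD (λ d → bit (E' (evE d)) + bit (E' (odE d)))
      ≡⟨ ΣD-cong (λ d → bit-xor (E' (evE d)) (E' (odE d)) (tie-pair d)) ⟩
    ΣD (λ _ → 1)
      ≡⟨ ΣD-const 1 ⟩
    n * 3 ∎
    where open ≡-Reasoning

  weight-sum : ΣFin n (weight ∘ gadgetAt) + n * 3 ≡ lengthOf E' + ∣ selected ∣
  weight-sum = begin
    ΣFin n (weight ∘ gadgetAt) + n * 3
      ≡⟨ cong (_+ n * 3) (ΣFin-+ n (cycleCost ∘ gadgetAt) (bit ∘ not ∘ closing ∘ gadgetAt)) ⟩
    ΣFin n (cycleCost ∘ gadgetAt) + ΣFin n (bit ∘ not ∘ closing ∘ gadgetAt) + n * 3
      ≡⟨ +-comm-last (ΣFin n (cycleCost ∘ gadgetAt)) _ (n * 3) ⟩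
    ΣFin n (cycleCost ∘ gadgetAt) + n * 3 + ΣFin n (bit ∘ not ∘ closing ∘ gadgetAt)
      ≡⟨ cong₂ (λ x y → ΣFin n (cycleCost ∘ gadgetAt) + x + y) (sym tie-edges) (sym ∣selected∣) ⟩
    lengthOf E' + ∣ selected ∣ ∎
    where
    open ≡-Reasoning
    ∣selected∣ : ∣ selected ∣ ≡ ΣFin n (bit ∘ not ∘ closing ∘ gadgetAt)
    ∣selected∣ = trans (∣∣≡ΣFin selected)
      (ΣFin-cong n (λ v → cong bit (lookup∘tabulate (not ∘ closing ∘ gadgetAt) v)))
    tie-edges : ΣD (λ d → wt (E' (evE d)) 1 + wt (E' (odE d)) 1) ≡ n * 3
    tie-edges = trans (ΣD-cong (λ d → trans (cong₂ _+_ (wt-1 (E' (evE d))) (wt-1 (E' (odE d))))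
                                            (bit-xor (E' (evE d)) (E' (odE d)) (tie-pair d))))
                      (ΣD-const 1)

  ΣFin-gadget-bound : ΣFin n (λ v → 12 * 2 + ties (gadgetAt v)) ≡ n * 24 + n * 3
  ΣFin-gadget-bound = trans (ΣFin-+ n (λ _ → 12 * 2) (ties ∘ gadgetAt)) (cong₂ _+_ (ΣFin-const n 24) ΣFin-ties)

  ΣFin-double-weight : ΣFin n (λ v → 2 * weight (gadgetAt v)) ≡ 2 * ΣFin n (weight ∘ gadgetAt)
  ΣFin-double-weight = ΣFin-*ˡ n 2 (weight ∘ gadgetAt)

  weight-bound : n * 24 + n * 3 ≤ 2 * ΣFin n (weight ∘ gadgetAt)
  weight-bound = subst₂ _≤_ ΣFin-gadget-bound ΣFin-double-weight
    (ΣFin-mono-≤ n (λ v → gadget-bound (gadgetAt v) (feasible-gadgetAt v)))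

  module _ {a : ℕ} (α-bound : ∀ S → Independent G S → ∣ S ∣ ≤ a) where

    length+α-lower-bound : 12 * n + 3 * numEdges n ≤ lengthOf E' + a
    length+α-lower-bound = length-lower-bound {n} {numEdges n} {ΣFin n (weight ∘ gadgetAt)} {lengthOf E'} {∣ selected ∣}
      (CubicCounts.numEdges-double G) weight-sum weight-bound
      (α-bound selected selected-independent)

    length+α-tight : lengthOf E' + a ≡ 12 * n + 3 * numEdges n →
      (∀ v → gadgetAt v ≡ canonicalOf (gadgetAt v)) × ∣ selected ∣ ≡ a
    length+α-tight tight = gadgets-canonical , proj₂ arithmetic
      where
      arithmetic = length-tight {n} {numEdges n} {ΣFin n (weight ∘ gadgetAt)} {lengthOf E'} {∣ selected ∣}
        (CubicCounts.numEdges-double G) weight-sum weight-bound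
        (α-bound selected selected-independent) tight
      gadgets-canonical : ∀ v → gadgetAt v ≡ canonicalOf (gadgetAt v)
      gadgets-canonical v = gadget-tight (gadgetAt v) (feasible-gadgetAt v)
        (sym (ΣFin-≤-tight n (λ v → gadget-bound (gadgetAt v) (feasible-gadgetAt v))
          (subst₂ _≤_ (sym ΣFin-double-weight) (sym ΣFin-gadget-bound) (proj₁ arithmetic)) v))

-- The solutions built from an independent set


weight-canonicalGadget : ∀ s r₀ r₁ r₂ → (s ≡ true → r₀ ≡ false × r₁ ≡ false × r₂ ≡ false) →
  weight (canonicalGadget s r₀ r₁ r₂) ≡ 12 + (bit r₀ + (bit r₁ + (bit r₂ + 0)))
weight-canonicalGadget true _ _ _ rs with rs refl
... | refl , refl , refl = refl
weight-canonicalGadget false true  true  true  _ = refl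
weight-canonicalGadget false true  true  false _ = refl
weight-canonicalGadget false true  false true  _ = refl
weight-canonicalGadget false true  false false _ = refl
weight-canonicalGadget false false true  true  _ = refl
weight-canonicalGadget false false true  false _ = refl
weight-canonicalGadget false false false true  _ = refl
weight-canonicalGadget false false false false _ = refl

crossing : (tail∈S head∈S canonical : Bool) → (side side′ : Bool) → Bool
crossing true  _     _     _ _  = false
crossing false true  _     _ _  = true
crossing false false true  x _  = x
crossing false false false _ x′ = not x′

crossing-swap : ∀ a b c c′ x x′ → (a ≡ true → b ≡ false) → bit c + bit c′ ≡ 1 →
  crossing b a c′ x′ x ≡ not (crossing a b c x x′)
crossing-swap true  true  _     _     _ _  a⇒¬b _ with a⇒¬b refl
... | ()
crossing-swap true  false _     _     _ _  _ _ = refl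
crossing-swap false true  _     _     _ _  _ _ = refl
crossing-swap false false true  false _ _  _ _ = refl
crossing-swap false false false true  _ x′ _ _ = sym (Bool.not-involutive x′)

cycleEdge : Gadget → Fin 8 → Bool
cycleEdge g k = lookup g (k ↑ˡ 6)

module IndependentSet {n : ℕ} (G : CubicMap n) (S : Subset n) (S-independent : Independent G S) where
  open Darts G

  inS : Fin n → Bool
  inS = lookup S

  inS-opp : ∀ d → inS (proj₁ d) ≡ true → inS (proj₁ (opp G d)) ≡ false
  inS-opp d d∈S with inS (proj₁ (opp G d)) in w∈S
  ... | false = refl
  ... | true  = ⊥-elim (S-independent d (lookup⇒[]= _ S d∈S) (lookup⇒[]= _ S w∈S))

  -- c d: the B-path of the edge of d crosses the gadget of the tail of d.
  gadgetFrom : (Dart n → Bool) → Fin n → Gadget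
  gadgetFrom c v = canonicalGadget (inS v) (c (v , # 0)) (c (v , # 1)) (c (v , # 2))

  solutionFrom : (Dart n → Bool) → EdgeSet n
  solutionFrom c (cycE v k) = cycleEdge (gadgetFrom c v) k
  solutionFrom c (evE d)    = c d
  solutionFrom c (odE d)    = c (opp G d)

  solutionFrom-cong : ∀ {c c′} → (∀ d → c d ≡ c′ d) → solutionFrom c ≐ solutionFrom c′
  solutionFrom-cong c≗c′ (cycE v k) rewrite c≗c′ (v , # 0) | c≗c′ (v , # 1) | c≗c′ (v , # 2) = refl
  solutionFrom-cong c≗c′ (evE d) = c≗c′ d
  solutionFrom-cong c≗c′ (odE d) = c≗c′ (opp G d)

  free : Dart n → Bool
  free d = not (inS (proj₁ d)) ∧ not (inS (proj₁ (opp G d)))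

  freeCanonical : Dart n → Bool
  freeCanonical d = canonical d ∧ free d

  freeDarts : List (Dart n)
  freeDarts = dartsWith freeCanonical

  -- Each edge has at most one end in S, so 3|S| edges touch S and the others are free.
  length-freeDarts : length freeDarts ≡ numEdges n ∸ 3 * ∣ S ∣
  length-freeDarts = begin
    length freeDarts       ≡⟨ length-dartsWith freeCanonical ⟩
    F                      ≡⟨ m+n∸n≡m F Tₛ ⟨
    F + Tₛ ∸ Tₛ              ≡⟨ cong₂ _∸_ F+T≡E tails-in-S ⟩
    numEdges n ∸ 3 * ∣ S ∣ ∎
    where
    open ≡-Reasoning
    F Tₛ H : ℕ
    F = ΣD (λ d → bit (canonical d ∧ free d))
    Tₛ = ΣD (bit ∘ inS ∘ proj₁)
    H = ΣD (λ d → bit (not (inS (proj₁ d)) ∧ inS (proj₁ (opp G d))))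
    tails-in-S : Tₛ ≡ 3 * ∣ S ∣
    tails-in-S = trans (ΣFin-cong n (λ v → ΣFin-const 3 (bit (inS v))))
      (trans (ΣFin-*ˡ n 3 (bit ∘ inS)) (cong (3 *_) (sym (∣∣≡ΣFin S))))
    free-pairs : F + F ≡ ΣD (bit ∘ free)
    free-pairs = begin
      F + F ≡⟨ cong (F +_) (ΣD-opp (λ d → bit (canonical d ∧ free d))) ⟨
      F + ΣD (λ d → bit (canonical (opp G d) ∧ free (opp G d)))
        ≡⟨ ΣD-+ (λ d → bit (canonical d ∧ free d)) (λ d → bit (canonical (opp G d) ∧ free (opp G d))) ⟨
      ΣD (λ d → bit (canonical d ∧ free d) + bit (canonical (opp G d) ∧ free (opp G d)))
        ≡⟨ ΣD-cong (λ d → split (canonical d) (canonical (opp G d)) (not (inS (proj₁ d))) (not (inS (proj₁ (opp G d))))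
                            (trans (cong (λ e → not (inS (proj₁ (opp G d))) ∧ not (inS (proj₁ e))) (opp-invol G d))
                                   (Bool.∧-comm (not (inS (proj₁ (opp G d)))) (not (inS (proj₁ d)))))
                            (canonical-opp d)) ⟩
      ΣD (bit ∘ free) ∎
      where
      split : ∀ c c′ x y {z} → z ≡ x ∧ y → bit c + bit c′ ≡ 1 → bit (c ∧ (x ∧ y)) + bit (c′ ∧ z) ≡ bit (x ∧ y)
      split true  false x y refl _ = +-identityʳ _
      split false true  x y refl _ = refl
    heads-in-S : H ≡ Tₛ
    heads-in-S = begin
      H ≡⟨ ΣD-opp (λ d → bit (not (inS (proj₁ d)) ∧ inS (proj₁ (opp G d)))) ⟨
      ΣD (λ d → bit (not (inS (proj₁ (opp G d))) ∧ inS (proj₁ (opp G (opp G d)))))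
        ≡⟨ ΣD-cong (λ d → trans (cong (λ e → bit (not (inS (proj₁ (opp G d))) ∧ inS (proj₁ e))) (opp-invol G d))
                                (head-outside (inS (proj₁ d)) _ (inS-opp d))) ⟩
      Tₛ ∎
      where
      head-outside : ∀ x y → (x ≡ true → y ≡ false) → bit (not y ∧ x) ≡ bit x
      head-outside true  y x⇒¬y rewrite x⇒¬y refl = refl
      head-outside false true  _ = refl
      head-outside false false _ = refl
    tails-outside : ΣD (bit ∘ not ∘ inS ∘ proj₁) ≡ ΣD (bit ∘ free) + H
    tails-outside = trans (ΣD-cong (λ d → outside (inS (proj₁ d)) (inS (proj₁ (opp G d)))))
                          (ΣD-+ (bit ∘ free) (λ d → bit (not (inS (proj₁ d)) ∧ inS (proj₁ (opp G d)))))
      where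
      outside : ∀ x y → bit (not x) ≡ bit (not x ∧ not y) + bit (not x ∧ y)
      outside true  _     = refl
      outside false true  = refl
      outside false false = refl
    all-tails : ΣD (bit ∘ not ∘ inS ∘ proj₁) + Tₛ ≡ n * 3
    all-tails = trans (sym (ΣD-+ (bit ∘ not ∘ inS ∘ proj₁) (bit ∘ inS ∘ proj₁)))
      (trans (ΣD-cong (λ d → trans (+-comm (bit (not (inS (proj₁ d)))) _) (bit-not (inS (proj₁ d)))))
             (ΣD-const 1))
    F+T≡E : F + Tₛ ≡ numEdges n
    F+T≡E = double-injective _ _ (begin
      (F + Tₛ) + (F + Tₛ)               ≡⟨ +-+-interchange F Tₛ F Tₛ ⟩
      (F + F) + (Tₛ + Tₛ)               ≡⟨ cong₂ _+_ free-pairs (cong (Tₛ +_) (sym heads-in-S)) ⟩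
      ΣD (bit ∘ free) + (Tₛ + H)       ≡⟨ cong (ΣD (bit ∘ free) +_) (+-comm Tₛ H) ⟩
      ΣD (bit ∘ free) + (H + Tₛ)       ≡⟨ +-assoc (ΣD (bit ∘ free)) H Tₛ ⟨
      ΣD (bit ∘ free) + H + Tₛ         ≡⟨ cong (_+ Tₛ) tails-outside ⟨
      ΣD (bit ∘ not ∘ inS ∘ proj₁) + Tₛ ≡⟨ all-tails ⟩
      n * 3                           ≡⟨ CubicCounts.numEdges-double G ⟨
      numEdges n + numEdges n ∎)

-- Given an independent set S and, for every edge with no endpoint in S, the side whose
-- gadget its B-path crosses (read from the canonical dart, negated on the other one).
module Construction {n : ℕ} (G : CubicMap n) (S : Subset n) (S-independent : Independent G S)
                    (side : Dart n → Bool) where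
  open Darts G
  open Paths G
  open IndependentSet G S S-independent

  crosses : Dart n → Bool
  crosses d = crossing (inS (proj₁ d)) (inS (proj₁ (opp G d))) (canonical d) (side d) (side (opp G d))

  crosses-opp : ∀ d → crosses (opp G d) ≡ not (crosses d)
  crosses-opp d = trans
    (cong (λ e → crossing (inS (proj₁ (opp G d))) (inS (proj₁ e)) (canonical (opp G d)) (side (opp G d)) (side e))
          (opp-invol G d))
    (crossing-swap (inS (proj₁ d)) _ (canonical d) _ (side d) _ (inS-opp d) (canonical-opp d))

  crosses-complementary : ∀ d → bit (crosses d) + bit (crosses (opp G d)) ≡ 1
  crosses-complementary d = trans (cong (λ b → bit (crosses d) + bit b) (crosses-opp d)) (bit-not (crosses d))

  crosses-at-S : ∀ v p → inS v ≡ true → crosses (v , p) ≡ false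
  crosses-at-S v p v∈S rewrite v∈S = refl

  gadgetOf : Fin n → Gadget
  gadgetOf = gadgetFrom crosses

  solution : EdgeSet n
  solution = solutionFrom crosses

  long-walk : ∀ v → Walk G (cyc v (# 0)) (cyc v last8)
  long-walk v = forward (# 0) (forward (# 1) (forward (# 2) (forward (# 3)
                (forward (# 4) (forward (# 5) (forward (# 6) (nil (cyc v last8))))))))
    where
    forward : ∀ k {z} → Walk G (cyc v (next8 k)) z → Walk G (cyc v k) z
    forward k = cons (cycE v k) (inj₁ refl)

  long-path short-path : Fin n → ABPath G
  long-path v = record
    { src = cyc v (# 0) ; tgt = cyc v last8 ; walk = long-walk v
    ; distinct = Unique.tabulate⁺ {f = cyc v} (λ { refl → refl })
    ; nonTriv = s≤s z≤n ; endsOK = inj₁ (inj₁ refl , inj₂ refl) }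
  short-path v = record
    { src = cyc v (# 0) ; tgt = cyc v last8
    ; walk = cons (cycE v last8) (inj₂ refl) (nil (cyc v last8))
    ; distinct = ((λ ()) ∷ []) ∷ [] ∷ []
    ; nonTriv = s≤s z≤n ; endsOK = inj₁ (inj₁ refl , inj₂ refl) }

  A-path : Fin n → ABPath G
  A-path v = if inS v then long-path v else short-path v

  private
    cyc-injective : ∀ {v w : Fin n} {a b} → cyc v a ≡ cyc w b → v ≡ w × a ≡ b
    cyc-injective refl = refl , refl

    ter-injective : ∀ {a b : Dart n} → ter {n} a ≡ ter b → a ≡ b
    ter-injective refl = refl

    inner-not-on-A-path : ∀ {v u k j} → inS u ≡ false → inS v ≡ true ⊎ role k ≡ terminal →
      v ≡ u × k ≡ j → role j ≢ terminal → ⊥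
    inner-not-on-A-path u∉S (inj₁ v∈S)  (refl , _)    _     = true≢false v∈S u∉S
    inner-not-on-A-path _   (inj₂ term) (_ , refl) inner = inner term

  B-path : Dart n → ABPath G
  B-path x@(u , p) = record
    { src = ter x ; tgt = ter (opp G x)
    ; walk = cons (evE x) (inj₁ refl)
            (cons (cycE u (evenIx p)) (inj₁ (cong (λ k → cyc u (evenIx p) , cyc u k) (next8-evenIx p)))
            (cons (odE (opp G x)) (inj₂ (cong (λ d → ter (opp G x) , cyc (proj₁ d) (oddIx (proj₂ d))) (opp-invol G x)))
            (nil (ter (opp G x)))))
    ; distinct = ((λ ()) ∷ (λ ()) ∷ (λ eq → no-loop G x (cong proj₁ (sym (ter-injective eq)))) ∷ [])
               ∷ ((λ eq → evenIx≢oddIx (proj₂ (cyc-injective eq))) ∷ (λ ()) ∷ [])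
               ∷ ((λ ()) ∷ []) ∷ [] ∷ []
    ; nonTriv = s≤s z≤n ; endsOK = inj₂ (tt , tt) }

  crossed : Dart n → Dart n
  crossed d = if crosses d then d else opp G d

  B-paths : List (ABPath G)
  B-paths = map (B-path ∘ crossed) (dartsWith canonical)

  all-paths : List (ABPath G)
  all-paths = map A-path (allFin n) ++ B-paths

  A-path-vertex : ∀ v {y} → y ∈ₗ wverts (walk (A-path v)) →
    ∃[ k ] (y ≡ cyc v k × (inS v ≡ true ⊎ role k ≡ terminal))
  A-path-vertex v = by-membership (inS v) refl
    where
    by-membership : ∀ b → inS v ≡ b → ∀ {y} → y ∈ₗ wverts (walk (if b then long-path v else short-path v)) →
      ∃[ k ] (y ≡ cyc v k × (inS v ≡ true ⊎ role k ≡ terminal))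
    by-membership true  v∈S y∈ with ∈-tabulate⁻ {f = cyc v} y∈
    ... | k , y≡ = k , y≡ , inj₁ v∈S
    by-membership false _ (here refl)         = # 0 , refl , inj₂ refl
    by-membership false _ (there (here refl)) = last8 , refl , inj₂ refl

  B-path-vertex : ∀ x {y} → y ∈ₗ wverts (walk (B-path x)) →
    y ≡ ter x ⊎ y ≡ ter (opp G x) ⊎ y ≡ cyc (proj₁ x) (evenIx (proj₂ x)) ⊎ y ≡ cyc (proj₁ x) (oddIx (proj₂ x))
  B-path-vertex x (here refl)                         = inj₁ refl
  B-path-vertex x (there (here refl))                 = inj₂ (inj₂ (inj₁ refl))
  B-path-vertex x (there (there (here refl)))         = inj₂ (inj₂ (inj₂ refl))
  B-path-vertex x (there (there (there (here refl)))) = inj₂ (inj₁ refl)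

  A-paths-disjoint : ∀ v w → v ≢ w → VDisjoint {G = G} (A-path v) (A-path w)
  A-paths-disjoint v w v≢w _ y∈ y∈′ with A-path-vertex v y∈ | A-path-vertex w y∈′
  ... | _ , refl , _ | _ , eq , _ = v≢w (proj₁ (cyc-injective eq))

  A-B-disjoint : ∀ v x → inS (proj₁ x) ≡ false → VDisjoint {G = G} (A-path v) (B-path x)
  A-B-disjoint v x x∉S _ y∈ y∈′ with A-path-vertex v y∈ | B-path-vertex x y∈′
  ... | _ , refl , _ | inj₁ ()
  ... | _ , refl , _ | inj₂ (inj₁ ())
  ... | k , refl , in-A | inj₂ (inj₂ (inj₁ eq)) = inner-not-on-A-path x∉S in-A (cyc-injective eq) (evenIx-inner _)
  ... | k , refl , in-A | inj₂ (inj₂ (inj₂ eq)) = inner-not-on-A-path x∉S in-A (cyc-injective eq) (oddIx-inner _)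

  private
    EdgeOf : Dart n → Dart n → Set
    EdgeOf d a = a ≡ d ⊎ a ≡ opp G d

    crossed-edge : ∀ d → EdgeOf d (crossed d)
    crossed-edge d with crosses d
    ... | true  = inj₁ refl
    ... | false = inj₂ refl

    EdgeOf-opp : ∀ {d a} → EdgeOf d a → EdgeOf d (opp G a)
    EdgeOf-opp (inj₁ refl)     = inj₂ refl
    EdgeOf-opp {d} (inj₂ refl) = inj₁ (opp-invol G d)

    canonical-edges-differ : ∀ {d e a b} → canonical d ≡ true → canonical e ≡ true → d ≢ e →
      EdgeOf d a → EdgeOf e b → a ≢ b
    canonical-edges-differ _  _  d≢e (inj₁ refl) (inj₁ refl) refl = d≢e refl
    canonical-edges-differ cd ce _   (inj₁ refl) (inj₂ refl) refl =
      true≢false cd (canonical⇒¬canonical-opp ce)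
    canonical-edges-differ cd ce _   (inj₂ refl) (inj₁ refl) refl =
      true≢false ce (canonical⇒¬canonical-opp cd)
    canonical-edges-differ {d} {e} _ _ d≢e (inj₂ refl) (inj₂ eq) refl =
      d≢e (trans (sym (opp-invol G d)) (trans (cong (opp G) eq) (opp-invol G e)))

    dart-≡ : ∀ {x y : Dart n} → proj₁ x ≡ proj₁ y → proj₂ x ≡ proj₂ y → x ≡ y
    dart-≡ refl refl = refl

  B-paths-disjoint : ∀ d e → canonical d ≡ true → canonical e ≡ true → d ≢ e →
    VDisjoint {G = G} (B-path (crossed d)) (B-path (crossed e))
  B-paths-disjoint d e cd ce d≢e _ y∈ y∈′
    with B-path-vertex (crossed d) y∈ | B-path-vertex (crossed e) y∈′
  ... | inj₁ refl        | inj₁ eq        = canonical-edges-differ cd ce d≢e (crossed-edge d) (crossed-edge e) (ter-injective eq)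
  ... | inj₁ refl        | inj₂ (inj₁ eq) = canonical-edges-differ cd ce d≢e (crossed-edge d) (EdgeOf-opp (crossed-edge e)) (ter-injective eq)
  ... | inj₂ (inj₁ refl) | inj₁ eq        = canonical-edges-differ cd ce d≢e (EdgeOf-opp (crossed-edge d)) (crossed-edge e) (ter-injective eq)
  ... | inj₂ (inj₁ refl) | inj₂ (inj₁ eq) =
    canonical-edges-differ cd ce d≢e (EdgeOf-opp (crossed-edge d)) (EdgeOf-opp (crossed-edge e)) (ter-injective eq)
  ... | inj₁ refl               | inj₂ (inj₂ (inj₁ ()))
  ... | inj₁ refl               | inj₂ (inj₂ (inj₂ ()))
  ... | inj₂ (inj₁ refl)        | inj₂ (inj₂ (inj₁ ()))
  ... | inj₂ (inj₁ refl)        | inj₂ (inj₂ (inj₂ ()))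
  ... | inj₂ (inj₂ (inj₁ refl)) | inj₁ ()
  ... | inj₂ (inj₂ (inj₁ refl)) | inj₂ (inj₁ ())
  ... | inj₂ (inj₂ (inj₂ refl)) | inj₁ ()
  ... | inj₂ (inj₂ (inj₂ refl)) | inj₂ (inj₁ ())
  ... | inj₂ (inj₂ (inj₁ refl)) | inj₂ (inj₂ (inj₁ eq)) = let v≡w , k≡j = cyc-injective eq in
    canonical-edges-differ cd ce d≢e (crossed-edge d) (crossed-edge e) (dart-≡ v≡w (evenIx-injective k≡j))
  ... | inj₂ (inj₂ (inj₂ refl)) | inj₂ (inj₂ (inj₂ eq)) = let v≡w , k≡j = cyc-injective eq in
    canonical-edges-differ cd ce d≢e (crossed-edge d) (crossed-edge e) (dart-≡ v≡w (oddIx-injective k≡j))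
  ... | inj₂ (inj₂ (inj₁ refl)) | inj₂ (inj₂ (inj₂ eq)) = evenIx≢oddIx (proj₂ (cyc-injective eq))
  ... | inj₂ (inj₂ (inj₂ refl)) | inj₂ (inj₂ (inj₁ eq)) = evenIx≢oddIx (sym (proj₂ (cyc-injective eq)))

  crossed-crosses : ∀ d → crosses (crossed d) ≡ true
  crossed-crosses d with crosses d in c
  ... | true  = c
  ... | false = trans (crosses-opp d) (cong not c)

  crossed-tail∉S : ∀ d → inS (proj₁ (crossed d)) ≡ false
  crossed-tail∉S d with inS (proj₁ (crossed d)) in u∈S
  ... | false = refl
  ... | true  = ⊥-elim (true≢false (crossed-crosses d) (crosses-at-S _ _ u∈S))

  all-paths-disjoint : AllPairs (VDisjoint {G = G}) all-paths
  all-paths-disjoint = AllPairs.++⁺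
    (AllPairs.map⁺ (AllPairs-map-∈ (λ _ _ → A-paths-disjoint _ _) (Unique.allFin⁺ n)))
    (AllPairs.map⁺ (AllPairs-map-∈ (λ d∈ e∈ → B-paths-disjoint _ _ (∈-dartsWith⁻ canonical d∈) (∈-dartsWith⁻ canonical e∈))
                                   (dartsWith-unique canonical)))
    (All.tabulate λ P∈ → All.tabulate λ Q∈ → A-B P∈ Q∈)
    where
    A-B : ∀ {P Q} → P ∈ₗ map A-path (allFin n) → Q ∈ₗ B-paths → VDisjoint {G = G} P Q
    A-B P∈ Q∈ with ∈-map⁻ A-path P∈ | ∈-map⁻ (B-path ∘ crossed) Q∈
    ... | v , _ , refl | d , _ , refl = A-B-disjoint v (crossed d) (crossed-tail∉S d)

  OnPath : EI n → Set
  OnPath e = Any (λ P → e ∈ₗ wedges (walk P)) all-paths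

  A-path-long : ∀ v → inS v ≡ true → A-path v ≡ long-path v
  A-path-long v v∈S rewrite v∈S = refl

  A-path-short : ∀ v → inS v ≡ false → A-path v ≡ short-path v
  A-path-short v v∉S rewrite v∉S = refl

  on-A-path : ∀ v {e} → e ∈ₗ wedges (walk (A-path v)) → OnPath e
  on-A-path v = lose (∈-++⁺ˡ (∈-map⁺ A-path (∈-allFin v)))

  on-long-path : ∀ v → inS v ≡ true → ∀ {e} → e ∈ₗ wedges (long-walk v) → OnPath e
  on-long-path v v∈S e∈ = on-A-path v (subst (λ P → _ ∈ₗ wedges (walk P)) (sym (A-path-long v v∈S)) e∈)

  crossed-self : ∀ {x} → crosses x ≡ true → crossed x ≡ x
  crossed-self {x} c = cong (λ b → if b then x else opp G x) c

  crossed-opp : ∀ {x} → crosses x ≡ true → crossed (opp G x) ≡ x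
  crossed-opp {x} c =
    trans (cong (λ b → if b then opp G x else opp G (opp G x)) (trans (crosses-opp x) (cong not c)))
          (opp-invol G x)

  canonical-crossing : ∀ x → crosses x ≡ true → ∃[ r ] (canonical r ≡ true × crossed r ≡ x)
  canonical-crossing x c = by-canonical (canonical x) refl
    where
    by-canonical : ∀ b → canonical x ≡ b → ∃[ r ] (canonical r ≡ true × crossed r ≡ x)
    by-canonical true  cx = x , cx , crossed-self c
    by-canonical false cx = opp G x , ¬canonical⇒canonical-opp cx , crossed-opp c

  B-path∈ : ∀ x → crosses x ≡ true → B-path x ∈ₗ all-paths
  B-path∈ x c with canonical-crossing x c
  ... | r , cr , crossed-r≡x = ∈-++⁺ʳ (map A-path (allFin n))
    (subst (_∈ₗ B-paths) (cong B-path crossed-r≡x) (∈-map⁺ (B-path ∘ crossed) (∈-dartsWith⁺ canonical r cr)))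

  on-B-path : ∀ x → crosses x ≡ true → ∀ {e} → e ∈ₗ wedges (walk (B-path x)) → OnPath e
  on-B-path x c = lose (B-path∈ x c)

  used⇒on-path : ∀ e → solution e ≡ true → OnPath e
  used⇒on-path (evE d) used = on-B-path d used (here refl)
  used⇒on-path (odE d) used = subst OnPath (cong odE (opp-invol G d)) (on-B-path (opp G d) used (there (there (here refl))))
  used⇒on-path (cycE v fz) used = on-long-path v used (here refl)
  used⇒on-path (cycE v (fs fz)) used with ∨-elim (inS v) used
  ... | inj₁ v∈S      = on-long-path v v∈S (there (here refl))
  ... | inj₂ crosses₀ = on-B-path (v , # 0) crosses₀ (there (here refl))
  used⇒on-path (cycE v (fs (fs fz))) used = on-long-path v used (there (there (here refl)))
  used⇒on-path (cycE v (fs (fs (fs fz)))) used with ∨-elim (inS v) used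
  ... | inj₁ v∈S      = on-long-path v v∈S (there (there (there (here refl))))
  ... | inj₂ crosses₁ = on-B-path (v , # 1) crosses₁ (there (here refl))
  used⇒on-path (cycE v (fs (fs (fs (fs fz))))) used = on-long-path v used (there (there (there (there (here refl)))))
  used⇒on-path (cycE v (fs (fs (fs (fs (fs fz)))))) used with ∨-elim (inS v) used
  ... | inj₁ v∈S      = on-long-path v v∈S (there (there (there (there (there (here refl))))))
  ... | inj₂ crosses₂ = on-B-path (v , # 2) crosses₂ (there (here refl))
  used⇒on-path (cycE v (fs (fs (fs (fs (fs (fs fz))))))) used =
    on-long-path v used (there (there (there (there (there (there (here refl)))))))
  used⇒on-path (cycE v (fs (fs (fs (fs (fs (fs (fs fz)))))))) used =
    on-A-path v (subst (λ P → cycE v last8 ∈ₗ wedges (walk P)) (sym (A-path-short v (not-true used))) (here refl))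
    where not-true : ∀ {b} → not b ≡ true → b ≡ false
          not-true {false} _ = refl

  cycleEdge-evenIx : ∀ v p → cycleEdge (gadgetOf v) (evenIx p) ≡ inS v ∨ crosses (v , p)
  cycleEdge-evenIx v fz           = refl
  cycleEdge-evenIx v (fs fz)      = refl
  cycleEdge-evenIx v (fs (fs fz)) = refl

  A-path-edge-used : ∀ v {e} → e ∈ₗ wedges (walk (A-path v)) → solution e ≡ true
  A-path-edge-used v = by-membership (inS v) refl
    where
    by-membership : ∀ b → inS v ≡ b → ∀ {e} →
      e ∈ₗ wedges (walk (if b then long-path v else short-path v)) → solution e ≡ true
    by-membership true  v∈S (here refl) = v∈S
    by-membership true  v∈S (there (here refl)) rewrite v∈S = refl
    by-membership true  v∈S (there (there (here refl))) = v∈S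
    by-membership true  v∈S (there (there (there (here refl)))) rewrite v∈S = refl
    by-membership true  v∈S (there (there (there (there (here refl))))) = v∈S
    by-membership true  v∈S (there (there (there (there (there (here refl)))))) rewrite v∈S = refl
    by-membership true  v∈S (there (there (there (there (there (there (here refl))))))) = v∈S
    by-membership false v∉S (here refl) = cong not v∉S

  B-path-edge-used : ∀ x → crosses x ≡ true → ∀ {e} → e ∈ₗ wedges (walk (B-path x)) → solution e ≡ true
  B-path-edge-used x c (here refl) = c
  B-path-edge-used x c (there (here refl)) =
    trans (cycleEdge-evenIx (proj₁ x) (proj₂ x)) (trans (cong (inS (proj₁ x) ∨_) c) (Bool.∨-zeroʳ _))
  B-path-edge-used x c (there (there (here refl))) = trans (cong crosses (opp-invol G x)) c

  on-path⇒used : ∀ e → OnPath e → solution e ≡ true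
  on-path⇒used e on-path with find on-path
  ... | P , P∈ , e∈ with ∈-++⁻ (map A-path (allFin n)) P∈
  ...   | inj₁ P∈A with ∈-map⁻ A-path P∈A
  ...     | v , _ , refl = A-path-edge-used v e∈
  on-path⇒used e on-path | P , P∈ , e∈ | inj₂ P∈B with ∈-map⁻ (B-path ∘ crossed) P∈B
  ...     | d , _ , refl = B-path-edge-used (crossed d) (crossed-crosses d) e∈

  all-paths-length : length all-paths ≡ numPaths n
  all-paths-length = double-injective _ _ (begin
    length all-paths + length all-paths
      ≡⟨ cong (λ k → k + k) (trans (length-++ (map A-path (allFin n))) (cong₂ _+_ A-count B-count)) ⟩
    (n + ΣD (bit ∘ canonical)) + (n + ΣD (bit ∘ canonical))
      ≡⟨ +-+-interchange n (ΣD (bit ∘ canonical)) n (ΣD (bit ∘ canonical)) ⟩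
    (n + n) + (ΣD (bit ∘ canonical) + ΣD (bit ∘ canonical))
      ≡⟨ cong₂ _+_ (n+n≡n*2 n) handshake ⟩
    n * 2 + n * 3
      ≡⟨ CubicCounts.numPaths-double G ⟨
    numPaths n + numPaths n ∎)
    where
    open ≡-Reasoning
    A-count : length (map A-path (allFin n)) ≡ n
    A-count = trans (length-map A-path (allFin n)) (length-tabulate (λ v → v))
    B-count : length B-paths ≡ ΣD (bit ∘ canonical)
    B-count = trans (length-map (B-path ∘ crossed) (dartsWith canonical)) (length-dartsWith canonical)
    n+n≡n*2 : ∀ n → n + n ≡ n * 2
    n+n≡n*2 = solve-∀

  crossing-count : ΣD (bit ∘ crosses) ≡ numEdges n
  crossing-count = double-injective _ _
    (trans (ΣD-complementary crosses crosses-complementary) (sym (CubicCounts.numEdges-double G)))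

  solution-length : lengthOf solution + ∣ S ∣ ≡ 12 * n + 3 * numEdges n
  solution-length = begin
    ΣFin n (cycleCost ∘ gadgetOf) + ties-length + ∣ S ∣
      ≡⟨ +-comm-last (ΣFin n (cycleCost ∘ gadgetOf)) ties-length ∣ S ∣ ⟩
    ΣFin n (cycleCost ∘ gadgetOf) + ∣ S ∣ + ties-length
      ≡⟨ cong₂ _+_ weights tie-count ⟩
    n * 12 + numEdges n + (numEdges n + numEdges n)
      ≡⟨ regroup n (numEdges n) ⟩
    12 * n + 3 * numEdges n ∎
    where
    open ≡-Reasoning
    ties-length : ℕ
    ties-length = ΣD (λ d → wt (crosses d) 1 + wt (crosses (opp G d)) 1)
    tie-count : ties-length ≡ numEdges n + numEdges n
    tie-count = begin
      ties-length  ≡⟨ ΣD-cong (λ d → trans (cong₂ _+_ (wt-1 (crosses d)) (wt-1 (crosses (opp G d))))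
                                           (crosses-complementary d)) ⟩
      ΣD (λ _ → 1) ≡⟨ ΣD-const 1 ⟩
      n * 3        ≡⟨ CubicCounts.numEdges-double G ⟨
      numEdges n + numEdges n ∎
    weights : ΣFin n (cycleCost ∘ gadgetOf) + ∣ S ∣ ≡ n * 12 + numEdges n
    weights = begin
      ΣFin n (cycleCost ∘ gadgetOf) + ∣ S ∣
        ≡⟨ cong (ΣFin n (cycleCost ∘ gadgetOf) +_) (trans (∣∣≡ΣFin S)
             (ΣFin-cong n (λ v → cong bit (sym (Bool.not-involutive (inS v)))))) ⟩
      ΣFin n (cycleCost ∘ gadgetOf) + ΣFin n (bit ∘ not ∘ closing ∘ gadgetOf)
        ≡⟨ ΣFin-+ n (cycleCost ∘ gadgetOf) (bit ∘ not ∘ closing ∘ gadgetOf) ⟨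
      ΣFin n (weight ∘ gadgetOf)
        ≡⟨ ΣFin-cong n (λ v → weight-canonicalGadget (inS v) _ _ _
             (λ v∈S → crosses-at-S v (# 0) v∈S , crosses-at-S v (# 1) v∈S , crosses-at-S v (# 2) v∈S)) ⟩
      ΣFin n (λ v → 12 + ΣFin 3 (λ p → bit (crosses (v , p))))
        ≡⟨ ΣFin-+ n (λ _ → 12) (λ v → ΣFin 3 (λ p → bit (crosses (v , p)))) ⟩
      ΣFin n (λ _ → 12) + ΣD (bit ∘ crosses)
        ≡⟨ cong₂ _+_ (ΣFin-const n 12) crossing-count ⟩
      n * 12 + numEdges n ∎
    regroup : ∀ n E → n * 12 + E + (E + E) ≡ 12 * n + 3 * E
    regroup = solve-∀

  solution-valid : Solution G solution
  solution-valid = all-paths , all-paths-length , all-paths-disjoint ,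
                   λ e → mk⇔ (used⇒on-path e) (on-path⇒used e)

  crosses-free : ∀ x → x ∈ₗ freeDarts → crosses x ≡ side x
  crosses-free x x∈ = by-cases (inS (proj₁ x)) (inS (proj₁ (opp G x))) (canonical x) refl refl refl
    (∈-dartsWith⁻ freeCanonical x∈)
    where
    by-cases : ∀ a b c → inS (proj₁ x) ≡ a → inS (proj₁ (opp G x)) ≡ b → canonical x ≡ c →
      c ∧ (not a ∧ not b) ≡ true → crossing a b c (side x) (side (opp G x)) ≡ side x
    by-cases false false true _ _ _ _ = refl

module Assignments {X : Set} (_≟ˣ_ : DecidableEquality X) where

  override : X → Bool → (X → Bool) → X → Bool
  override x b g y = if does (y ≟ˣ x) then b else g y

  override-here : ∀ x b g → override x b g x ≡ b
  override-here x b g rewrite dec-true (x ≟ˣ x) refl = refl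

  override-there : ∀ x b g y → y ≢ x → override x b g y ≡ g y
  override-there x b g y y≢x rewrite dec-false (y ≟ˣ x) y≢x = refl

  -- Assignments are false outside xs.
  assignments : List X → List (X → Bool)
  assignments []       = (λ _ → false) ∷ []
  assignments (x ∷ xs) = map (override x true) (assignments xs) ++ map (override x false) (assignments xs)

  length-assignments : ∀ xs → length (assignments xs) ≡ 2 ^ length xs
  length-assignments []       = refl
  length-assignments (x ∷ xs) = begin
    length (map (override x true) (assignments xs) ++ map (override x false) (assignments xs))
      ≡⟨ length-++ (map (override x true) (assignments xs)) ⟩
    length (map (override x true) (assignments xs)) + length (map (override x false) (assignments xs))
      ≡⟨ cong₂ _+_ (length-map (override x true) (assignments xs)) (length-map (override x false) (assignments xs)) ⟩
    length (assignments xs) + length (assignments xs)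
      ≡⟨ cong (λ k → k + k) (length-assignments xs) ⟩
    2 ^ length xs + 2 ^ length xs
      ≡⟨ cong (2 ^ length xs +_) (+-identityʳ (2 ^ length xs)) ⟨
    2 ^ suc (length xs) ∎
    where open ≡-Reasoning

  AgreeOn : List X → (X → Bool) → (X → Bool) → Set
  AgreeOn xs g f = ∀ y → y ∈ₗ xs → g y ≡ f y

  assignments-complete : ∀ xs f → Any (λ g → AgreeOn xs g f) (assignments xs)
  assignments-complete []       f = here (λ _ ())
  assignments-complete (x ∷ xs) f with f x in fx
  ... | true  = Any.++⁺ˡ (Any.gmap extend (assignments-complete xs f))
    where
    extend : ∀ {g} → AgreeOn xs g f → AgreeOn (x ∷ xs) (override x true g) f
    extend {g} agree y (here refl) = trans (override-here y true g) (sym fx)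
    extend {g} agree y (there y∈) with y ≟ˣ x
    ... | yes refl = sym fx
    ... | no _     = agree y y∈
  ... | false = Any.++⁺ʳ (map (override x true) (assignments xs)) (Any.gmap extend (assignments-complete xs f))
    where
    extend : ∀ {g} → AgreeOn xs g f → AgreeOn (x ∷ xs) (override x false g) f
    extend {g} agree y (here refl) = trans (override-here y false g) (sym fx)
    extend {g} agree y (there y∈) with y ≟ˣ x
    ... | yes refl = sym fx
    ... | no _     = agree y y∈

  DifferOn : List X → (X → Bool) → (X → Bool) → Set
  DifferOn xs g h = ∃[ y ] (y ∈ₗ xs × g y ≢ h y)

  assignments-differ : ∀ xs → Unique xs → AllPairs (DifferOn xs) (assignments xs)
  assignments-differ []       _             = [] ∷ []
  assignments-differ (x ∷ xs) (x∉xs ∷ uniq) = AllPairs.++⁺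
    (AllPairs.map⁺ (AllPairs-map-∈ (λ _ _ → extend) (assignments-differ xs uniq)))
    (AllPairs.map⁺ (AllPairs-map-∈ (λ _ _ → extend) (assignments-differ xs uniq)))
    (All.tabulate λ g∈ → All.tabulate λ h∈ → at-x g∈ h∈)
    where
    extend : ∀ {b g h} → DifferOn xs g h → DifferOn (x ∷ xs) (override x b g) (override x b h)
    extend {b} {g} {h} (y , y∈ , gy≢hy) = y , there y∈ , λ eq →
      gy≢hy (trans (sym (override-there x b g y y≢x)) (trans eq (override-there x b h y y≢x)))
      where y≢x = λ y≡x → All.lookup x∉xs y∈ (sym y≡x)
    at-x : ∀ {g h} → g ∈ₗ map (override x true) (assignments xs) → h ∈ₗ map (override x false) (assignments xs) →
      DifferOn (x ∷ xs) g h
    at-x g∈ h∈ with ∈-map⁻ (override x true) g∈ | ∈-map⁻ (override x false) h∈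
    ... | g , _ , refl | h , _ , refl = x , here refl , λ eq →
      true≢false (trans (sym eq) (override-here x true g)) (override-here x false h)

-- Counting the solutions built from one independent set

module SideChoices {n : ℕ} (G : CubicMap n) (S : Subset n) (S-independent : Independent G S) where
  open Darts G
  open IndependentSet G S S-independent
  open Assignments (_≟ᴰ_ {n})
  module C = Construction G S S-independent

  crosses-agree : ∀ side side′ → AgreeOn freeDarts side side′ → ∀ d → C.crosses side d ≡ C.crosses side′ d
  crosses-agree side side′ agree d =
    by-cases (inS (proj₁ d)) (inS (proj₁ (opp G d))) (canonical d) refl refl refl
    where
    by-cases : ∀ a b c → inS (proj₁ d) ≡ a → inS (proj₁ (opp G d)) ≡ b → canonical d ≡ c →
      crossing a b c (side d) (side (opp G d)) ≡ crossing a b c (side′ d) (side′ (opp G d))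
    by-cases true  _     _     _  _  _  = refl
    by-cases false true  _     _  _  _  = refl
    by-cases false false true  ea eb ec =
      agree d (∈-dartsWith⁺ freeCanonical d (cong₂ _∧_ ec (cong₂ _∧_ (cong not ea) (cong not eb))))
    by-cases false false false ea eb ec = cong not (agree (opp G d) (∈-dartsWith⁺ freeCanonical (opp G d)
      (cong₂ _∧_ (¬canonical⇒canonical-opp ec)
        (cong₂ _∧_ (cong not eb) (trans (cong (λ e → not (inS (proj₁ e))) (opp-invol G d)) (cong not ea))))))

  solutions : List (EdgeSet n)
  solutions = map C.solution (assignments freeDarts)

  length-solutions : length solutions ≡ 2 ^ (numEdges n ∸ 3 * ∣ S ∣)
  length-solutions = trans (length-map C.solution (assignments freeDarts))
    (trans (length-assignments freeDarts) (cong (2 ^_) length-freeDarts))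

  solutions-distinct : AllPairs (λ E₁ E₂ → ¬ E₁ ≐ E₂) solutions
  solutions-distinct = AllPairs.map⁺ {f = C.solution} (AllPairs-map-∈ (λ _ _ → differ)
    (assignments-differ freeDarts (dartsWith-unique freeCanonical)))
    where
    differ : ∀ {g h} → DifferOn freeDarts g h → ¬ C.solution g ≐ C.solution h
    differ {g} {h} (x , x∈ , gx≢hx) same =
      gx≢hx (trans (sym (C.crosses-free g x x∈)) (trans (same (evE x)) (C.crosses-free h x x∈)))

  solutions-complete : ∀ side → Any (C.solution side ≐_) solutions
  solutions-complete side = Any.gmap (λ {g} agree → solutionFrom-cong {C.crosses side} {C.crosses g} (crosses-agree side g (λ y y∈ → sym (agree y y∈))))
    (assignments-complete freeDarts side)

-- Every optimal solution is built from a maximum independent set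

module OptimalSolution {n : ℕ} (G : CubicMap n) (E' : EdgeSet n) (sol : Solution G E')
                       {a : ℕ} (α-bound : ∀ S → Independent G S → ∣ S ∣ ≤ a)
                       (optimal : lengthOf E' + a ≡ 12 * n + 3 * numEdges n) where
  open Darts G
  open SolutionGadgets G E' sol
  open IndependentSet G selected selected-independent
  module C = Construction G selected selected-independent

  gadgets-canonical : ∀ v → gadgetAt v ≡ canonicalOf (gadgetAt v)
  gadgets-canonical = proj₁ (length+α-tight α-bound optimal)

  selected-maximum : ∣ selected ∣ ≡ a
  selected-maximum = proj₂ (length+α-tight α-bound optimal)

  tie-twins : ∀ v p → E' (odE (opp G (v , p))) ≡ E' (evE (v , p))
  tie-twins v fz           = cong (λ g → lookup g (# 9))  (gadgets-canonical v)
  tie-twins v (fs fz)      = cong (λ g → lookup g (# 11)) (gadgets-canonical v)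
  tie-twins v (fs (fs fz)) = cong (λ g → lookup g (# 13)) (gadgets-canonical v)

  odE≡evE-opp : ∀ d → E' (odE d) ≡ E' (evE (opp G d))
  odE≡evE-opp d with opp G d | opp-invol G d
  ... | v , p | refl = tie-twins v p

  cycleEdge-gadgetAt : ∀ v k → cycleEdge (gadgetAt v) k ≡ E' (cycE v k)
  cycleEdge-gadgetAt v fz                                     = refl
  cycleEdge-gadgetAt v (fs fz)                                = refl
  cycleEdge-gadgetAt v (fs (fs fz))                           = refl
  cycleEdge-gadgetAt v (fs (fs (fs fz)))                      = refl
  cycleEdge-gadgetAt v (fs (fs (fs (fs fz))))                 = refl
  cycleEdge-gadgetAt v (fs (fs (fs (fs (fs fz)))))            = refl
  cycleEdge-gadgetAt v (fs (fs (fs (fs (fs (fs fz))))))       = refl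
  cycleEdge-gadgetAt v (fs (fs (fs (fs (fs (fs (fs fz))))))) = refl

  built-from-ties : E' ≐ solutionFrom (E' ∘ evE)
  built-from-ties (evE d)    = refl
  built-from-ties (odE d)    = odE≡evE-opp d
  built-from-ties (cycE v k) = begin
    E' (cycE v k)                            ≡⟨ cycleEdge-gadgetAt v k ⟨
    cycleEdge (gadgetAt v) k                 ≡⟨ cong (λ g → cycleEdge g k) (gadgets-canonical v) ⟩
    cycleEdge (canonicalOf (gadgetAt v)) k   ≡⟨ cong (λ s → cycleEdge (canonicalGadget s _ _ _) k)
                                                     (sym (lookup∘tabulate (not ∘ closing ∘ gadgetAt) v)) ⟩
    cycleEdge (gadgetFrom (E' ∘ evE) v) k    ∎
    where open ≡-Reasoning

  crosses≡tie : ∀ d → C.crosses (E' ∘ evE) d ≡ E' (evE d)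
  crosses≡tie d = by-cases (inS (proj₁ d)) (inS (proj₁ (opp G d))) (canonical d) refl refl refl
    where
    tie-pair-d : E' (evE d) ≡ not (E' (odE d))
    tie-pair-d with E' (evE d) | E' (odE d) | tie-pair d
    ... | true  | false | _ = refl
    ... | false | true  | _ = refl
    by-cases : ∀ a b c → inS (proj₁ d) ≡ a → inS (proj₁ (opp G d)) ≡ b → canonical d ≡ c →
      crossing a b c (E' (evE d)) (E' (evE (opp G d))) ≡ E' (evE d)
    by-cases true  _     _     u∈ _  _ = sym (evE-at-selected d (lookup⇒[]= _ selected u∈))
    by-cases false true  _     _  w∈ _ =
      sym (trans tie-pair-d (cong not (odE-at-selected d (lookup⇒[]= _ selected w∈))))
    by-cases false false true  _  _  _ = refl
    by-cases false false false _  _  _ = sym (trans tie-pair-d (cong not (odE≡evE-opp d)))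

  is-constructed : E' ≐ C.solution (E' ∘ evE)
  is-constructed e = trans (built-from-ties e) (solutionFrom-cong (λ d → sym (crosses≡tie d)) e)

module Reduction {n : ℕ} (G : CubicMap n) (a : ℕ) (α : IsIndepNumber G a) where
  open Darts G

  bound : ℕ
  bound = 12 * n + 3 * numEdges n

  ℓ : ℕ
  ℓ = bound ∸ a

  α-bound : ∀ S → Independent G S → ∣ S ∣ ≤ a
  α-bound = proj₂ α

  a≤bound : a ≤ bound
  a≤bound with proj₁ α
  ... | S , _ , refl = ≤-trans (∣p∣≤n S) (≤-trans (m≤n*m n 12) (m≤m+n (12 * n) (3 * numEdges n)))

  constructed-optimal : ∀ S S-independent side → ∣ S ∣ ≡ a →
    OptSolution G ℓ (Construction.solution G S S-independent side)
  constructed-optimal S S-independent side ∣S∣≡a =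
    C.solution-valid , trans (sym (m+n∸n≡m _ a)) (cong (_∸ a) (trans (cong (_ +_) (sym ∣S∣≡a)) C.solution-length))
    where module C = Construction G S S-independent side

  solution-lower-bound : ∀ E' → Solution G E' → ℓ ≤ lengthOf E'
  solution-lower-bound E' sol = subst (ℓ ≤_) (m+n∸n≡m (lengthOf E') a)
    (∸-monoˡ-≤ a (SolutionGadgets.length+α-lower-bound G E' sol α-bound))

  optimal-length : IsMinLength G ℓ
  optimal-length with proj₁ α
  ... | S , S-independent , ∣S∣≡a =
    (_ , constructed-optimal S S-independent (λ _ → false) ∣S∣≡a) , solution-lower-bound

  optimal⇒tight : ∀ {E'} → OptSolution G ℓ E' → lengthOf E' + a ≡ bound
  optimal⇒tight (_ , length≡ℓ) = trans (cong (_+ a) length≡ℓ) (m∸n+n≡m a≤bound)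

  listed-solutions : ∀ Ss → All (MaxIndep G a) Ss → List (EdgeSet n)
  listed-solutions []       []                       = []
  listed-solutions (S ∷ Ss) ((S-independent , _) ∷ maxs) =
    SideChoices.solutions G S S-independent ++ listed-solutions Ss maxs

  length-listed-solutions : ∀ Ss maxs →
    length (listed-solutions Ss maxs) ≡ length Ss * 2 ^ (numEdges n ∸ 3 * a)
  length-listed-solutions []       []                              = refl
  length-listed-solutions (S ∷ Ss) ((S-independent , ∣S∣≡a) ∷ maxs) =
    trans (length-++ (SideChoices.solutions G S S-independent))
      (cong₂ _+_ (trans (SideChoices.length-solutions G S S-independent) (cong (λ s → 2 ^ (numEdges n ∸ 3 * s)) ∣S∣≡a))
                 (length-listed-solutions Ss maxs))

  listed-solutions-optimal : ∀ Ss maxs → All (OptSolution G ℓ) (listed-solutions Ss maxs)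
  listed-solutions-optimal []       []                              = []
  listed-solutions-optimal (S ∷ Ss) ((S-independent , ∣S∣≡a) ∷ maxs) = All.++⁺
    (All.map⁺ (All.tabulate (λ {side} _ → constructed-optimal S S-independent side ∣S∣≡a)))
    (listed-solutions-optimal Ss maxs)

  closing-edges : ∀ Ss maxs {E″} → E″ ∈ₗ listed-solutions Ss maxs →
    ∃[ S ] (S ∈ₗ Ss × (∀ v → E″ (cycE v last8) ≡ not (lookup S v)))
  closing-edges (S ∷ Ss) ((S-independent , _) ∷ maxs) E″∈ with ∈-++⁻ (SideChoices.solutions G S S-independent) E″∈
  ... | inj₁ E″∈S with ∈-map⁻ (Construction.solution G S S-independent) E″∈S
  ...   | _ , _ , refl = S , here refl , λ v → refl
  closing-edges (S ∷ Ss) ((S-independent , _) ∷ maxs) E″∈ | inj₂ E″∈Ss with closing-edges Ss maxs E″∈Ss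
  ...   | S′ , S′∈ , closing = S′ , there S′∈ , closing

  listed-solutions-distinct : ∀ Ss maxs → AllPairs (λ S S′ → ¬ S ≡ S′) Ss →
    AllPairs (λ E₁ E₂ → ¬ E₁ ≐ E₂) (listed-solutions Ss maxs)
  listed-solutions-distinct []       []                              _                = []
  listed-solutions-distinct (S ∷ Ss) ((S-independent , _) ∷ maxs) (S∉Ss ∷ distinct) = AllPairs.++⁺
    (SideChoices.solutions-distinct G S S-independent) (listed-solutions-distinct Ss maxs distinct)
    (All.tabulate λ E₁∈ → All.tabulate λ E₂∈ same → different-S E₁∈ E₂∈ same)
    where
    different-S : ∀ {E₁ E₂} → E₁ ∈ₗ SideChoices.solutions G S S-independent →
      E₂ ∈ₗ listed-solutions Ss maxs → ¬ E₁ ≐ E₂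
    different-S E₁∈ E₂∈ same
      with ∈-map⁻ (Construction.solution G S S-independent) E₁∈ | closing-edges Ss maxs E₂∈
    ... | _ , _ , refl | S′ , S′∈ , closing = All.lookup S∉Ss S′∈ (begin
      S                    ≡⟨ tabulate∘lookup S ⟨
      tabulate (lookup S)  ≡⟨ tabulate-cong (λ v → not-injective (trans (same (cycE v last8)) (closing v))) ⟩
      tabulate (lookup S′) ≡⟨ tabulate∘lookup S′ ⟩
      S′                   ∎)
      where open ≡-Reasoning

  listed-solutions-complete : ∀ Ss maxs → (∀ S → MaxIndep G a S → Any (S ≡_) Ss) →
    ∀ E' → OptSolution G ℓ E' → Any (E' ≐_) (listed-solutions Ss maxs)
  listed-solutions-complete Ss maxs Ss-complete E' opt@(sol , _) =
    find-set Ss maxs (Ss-complete selected (selected-independent , selected-maximum))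
    where
    open SolutionGadgets G E' sol using (selected; selected-independent)
    open OptimalSolution G E' sol α-bound (optimal⇒tight opt) using (selected-maximum; is-constructed)
    find-set : ∀ Ss maxs → Any (selected ≡_) Ss → Any (E' ≐_) (listed-solutions Ss maxs)
    find-set (S ∷ Ss) ((S-independent , _) ∷ maxs) (here refl) = Any.++⁺ˡ (Any.map
      (λ same e → trans (is-constructed e) (same e)) (SideChoices.solutions-complete G S S-independent (E' ∘ evE)))
    find-set (S ∷ Ss) ((S-independent , _) ∷ maxs) (there S∈) =
      Any.++⁺ʳ (SideChoices.solutions G S S-independent) (find-set Ss maxs S∈)

  solution-count : ∀ N M → CountOf _≡_ (MaxIndep G a) N → CountOf _≐_ (OptSolution G ℓ) M →
    M ≡ N * 2 ^ (numEdges n ∸ 3 * a)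
  solution-count N M indepSets optSolutions = ≤-antisym
    (subst₂ _≤_ Opt.size length≡ (length-≤-by-matching _≐_ ≐-join Opt.elems listed Opt.distinct
      (All.map (λ {E'} opt → listed-solutions-complete Indep.elems Indep.sound Indep.complete E' opt) Opt.sound)))
    (subst₂ _≤_ length≡ Opt.size (length-≤-by-matching _≐_ ≐-join listed Opt.elems
      (listed-solutions-distinct Indep.elems Indep.sound Indep.distinct)
      (All.map (λ {E'} opt → Opt.complete E' opt) (listed-solutions-optimal Indep.elems Indep.sound))))
    where
    module Indep = CountOf indepSets
    module Opt = CountOf optSolutions
    listed = listed-solutions Indep.elems Indep.sound
    length≡ : length listed ≡ N * 2 ^ (numEdges n ∸ 3 * a)
    length≡ = trans (length-listed-solutions Indep.elems Indep.sound) (cong (_* 2 ^ (numEdges n ∸ 3 * a)) Indep.size)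
    ≐-join : ∀ {E₁ E₂ E₃ : EdgeSet n} → E₁ ≐ E₂ → E₃ ≐ E₂ → E₁ ≐ E₃
    ≐-join p q e = trans (p e) (sym (q e))

lemma6 : (n : ℕ) (G : CubicMap n) → Planar G →
    (a : ℕ) → IsIndepNumber G a →
    ∃[ ℓ ] (IsMinLength G ℓ
      × a + ℓ ≡ 12 * n + 3 * numEdges n
      × ((N S : ℕ) → CountOf _≡_ (MaxIndep G a) N → CountOf _≐_ (OptSolution G ℓ) S →
          S ≡ N * 2 ^ (numEdges n ∸ 3 * a)))
lemma6 n G _ a α = ℓ , optimal-length , m+[n∸m]≡n a≤bound , solution-count
  where open Reduction G a α
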